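{- Let $G_1$, $G_2$ and $P_s$ be pairwise vertex-disjoint connected graphs such that: $G_1$ contains an edge $uv$ with $N_{G_1}(u)\setminus\{v\}=N_{G_1}(v)\setminus\{u\}=\{w_1,w_2,\ldots,w_k\}$ for some $k\ge 1$; $G_2$ contains a shortest path $x_1x_2\cdots x_t$ from $x_1$ to $x_t$ with $t\ge s+2$; and $P_s=z_1z_2\cdots z_s$ is a path on $s$ vertices. Let $G$ be the graph obtained from $G_1$ by identifying $u$ with the vertex $x_1$ of $G_2$ and identifying $v$ with the vertex $z_1$ of $P_s$, and let $$G'=G-\{vw_1,vw_2,\ldots,vw_k\}+\{x_2w_1,x_2w_2,\ldots,x_2w_k\}.$$ Then $H(G)<H(G')$.
   Context: All graphs are finite and simple. For a graph $G$, $d_G(u,v)$ is the length of a shortest $u$–$v$ path, and the Harary index is $H(G)=\sum_{\{u,v\}\subseteq V(G),\,u\neq v} \frac{1}{d_G(u,v)}$ (sum over unordered pairs of distinct vertices; for a disconnected graph, pairs in different components contribute $0$, i.e. $H(G)$ is the sum of the Harary indices of its components). $N_G(v)$ denotes the set of neighbours of $v$ in $G$. For a set of edges $E_1\subseteq E(G)$, $G-E_1$ is obtained by deleting these edges; for a set $E_2$ of non-edges with endpoints in $V(G)$, $G+E_2$ is obtained by adding these edges. -}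

module Defs where

open import Data.Bool using (Bool; true; false; _∧_; _∨_; not; if_then_else_; T)
open import Data.Nat using (ℕ; zero; suc; _+_; _<ᵇ_; _≡ᵇ_)
open import Data.Fin using (Fin; zero; suc; toℕ; _↑ˡ_; _↑ʳ_; punchOut; _≟_)
open import Data.List using (List; map; foldr; allFin)
open import Data.Bool.ListAction using (any)
open import Data.Maybe using (Maybe; just; nothing)
open import Data.Product using (_×_; Σ; ∃; _,_)
open import Data.Rational using (ℚ; 0ℚ; _/_) renaming (_+_ to _+ℚ_)
open import Data.Integer using (+_)
open import Relation.Binary.PropositionalEquality using (_≡_; _≢_)
open import Relation.Nullary using (yes; no; does)

Graph : ℕ → Set
Graph n = Fin n → Fin n → Bool

IsSimple : ∀ {n} → Graph n → Set
IsSimple {n} G = (∀ (i j : Fin n) → G i j ≡ G j i) × (∀ (i : Fin n) → G i i ≡ false)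

_==F_ : ∀ {n} → Fin n → Fin n → Bool
p ==F q = does (p ≟ q)

-- within G k u v = true  iff  there is a u–v walk of length at most k
within : ∀ {n} → Graph n → ℕ → Fin n → Fin n → Bool
within G zero    u v = u ==F v
within {n} G (suc k) u v = within G k u v ∨ any (λ w → G u w ∧ within G k w v) (allFin n)

Connected : ∀ {n} → Graph n → Set
Connected G = ∀ u v → ∃ λ k → T (within G k u v)

-- least i in [start, start+fuel) with p i
firstFrom : (ℕ → Bool) → ℕ → ℕ → Maybe ℕ
firstFrom p zero    i = nothing
firstFrom p (suc f) i = if p i then just i else firstFrom p f (suc i)

-- d_G(u,v): length of a shortest u–v path (nothing if u, v lie in different components)
dist : ∀ {n} → Graph n → Fin n → Fin n → Maybe ℕ
dist {n} G u v = firstFrom (λ k → within G k u v) (suc n) 0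

recipDist : Maybe ℕ → ℚ
recipDist nothing        = 0ℚ
recipDist (just zero)    = 0ℚ   -- never used: only distinct pairs are summed
recipDist (just (suc d)) = + 1 / suc d

sumℚ : List ℚ → ℚ
sumℚ = foldr _+ℚ_ 0ℚ

-- Harary index: sum over unordered pairs {u,v}, u ≠ v (encoded as toℕ u < toℕ v)
harary : ∀ {n} → Graph n → ℚ
harary {n} G = sumℚ (map (λ i → sumℚ (map (λ j →
  if toℕ i <ᵇ toℕ j then recipDist (dist G i j) else 0ℚ) (allFin n))) (allFin n))

-- the path P_s on vertices z_1 … z_s, here Fin s with z_{i+1} = i
pathGraph : (s : ℕ) → Graph s
pathGraph s i j = (suc (toℕ i) ≡ᵇ toℕ j) ∨ (suc (toℕ j) ≡ᵇ toℕ i)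

imgAdj : ∀ {m n} → (Fin m → Fin n) → Graph m → Graph n
imgAdj {m} f H p q = any (λ i → any (λ j → H i j ∧ (f i ==F p) ∧ (f j ==F q)) (allFin m)) (allFin m)

_∪G_ : ∀ {n} → Graph n → Graph n → Graph n
(A ∪G B) p q = A p q ∨ B p q

module Glue {a b s' : ℕ} (G1 : Graph a) (u v : Fin a)
            (G2 : Graph (suc b)) (x1 : Fin (suc b)) where
  -- vertex set of G: V(G1) ⊎ (V(G2) ∖ {x1}) ⊎ (V(P_s) ∖ {z1}), as Fin (a + (b + s'))
  N : ℕ
  N = a + (b + s')

  ι1 : Fin a → Fin N
  ι1 i = i ↑ˡ (b + s')

  ι2 : Fin (suc b) → Fin N
  ι2 y with x1 ≟ y
  ... | yes _   = ι1 u
  ... | no x1≢y = a ↑ʳ (punchOut x1≢y ↑ˡ s')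

  ι3 : Fin (suc s') → Fin N
  ι3 zero    = ι1 v
  ι3 (suc j) = a ↑ʳ (b ↑ʳ j)

  G : Graph N
  G = imgAdj ι1 G1 ∪G (imgAdj ι2 G2 ∪G imgAdj ι3 (pathGraph (suc s')))

  module Modify {k : ℕ} (w : Fin k → Fin a) (x2 : Fin (suc b)) where
    inW : Fin N → Bool
    inW p = any (λ i → ι1 (w i) ==F p) (allFin k)

    starTo : Fin N → Fin N → Fin N → Bool
    starTo c p q = ((p ==F c) ∧ inW q) ∨ ((q ==F c) ∧ inW p)

    G' : Graph N
    G' p q = (G p q ∧ not (starTo (ι1 v) p q)) ∨ starTo (ι2 x2) p q

-- In G' every inner vertex y of G1 (y ≠ u, v) moves closer to the geodesic x_2 … x_{s+2}
-- and at most one step away from the path z_1 … z_s, while no other pair gets farther apart: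
-- each such pair is fixed by a map G → G' that sends edges to edges or collapses them.
-- With d = d_{G1}(y, u) ≥ 1, the distance from y to z_{c+1} goes from at least d + c
-- (v has no neighbours beyond those of u) to at most d + c + 1, a loss of at most
-- 1/(d+c) − 1/(d+c+1), while the distance to x_{m+2} goes from at least d + m + 1
-- (x_1 … x_t is a geodesic) to at most d + m, a gain of at least 1/(d+m) − 1/(d+m+1).
-- The gains for m = 0 … s exceed the losses for c = 0 … s−1 by the gain for m = s,
-- which is positive, and k ≥ 1 provides an inner vertex.

module Submission where

open import Defs
open import Data.Bool using (Bool; true; false; _∧_; _∨_; not; if_then_else_; T)
open import Data.Bool.Properties using (∨-comm; ∧-zeroʳ; ⇔→≡)
open import Data.Bool.ListAction using (any)
open import Data.Nat using (ℕ; zero; suc; _+_; _∸_; _≤_; _<_; z≤n; s≤s; _<ᵇ_; _≡ᵇ_; _≤?_)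
open import Data.Nat.Properties
  using ( ≤-refl; ≤-reflexive; ≤-trans; <-≤-trans; <-trans; <⇒≤; ≰⇒>; ≤-pred; n≤1+n; <-irrefl; <-cmp
        ; m≤m+n; +-comm; +-suc; +-assoc; +-identityʳ; +-monoʳ-≤; +-monoˡ-≤; +-monoʳ-<; +-cancelʳ-≤
        ; m+[n∸m]≡n; n≤0⇒n≡0; m∸n+n≡m; m≤n⇒m<n∨m≡n; suc-injective; <⇒≢
        ; ≡ᵇ⇒≡; ≡⇒≡ᵇ; <ᵇ⇒<; <⇒<ᵇ )
open import Data.Fin using (Fin; zero; suc; toℕ; _≟_; _↑ˡ_; _↑ʳ_; punchOut; punchIn; splitAt; inject₁; fromℕ; fromℕ<)
open import Data.Fin.Properties
  using ( toℕ<n; toℕ-injective; toℕ-↑ˡ; toℕ-↑ʳ; ↑ˡ-injective; ↑ʳ-injective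
        ; punchOut-injective; punchOut-cong; punchOut-punchIn; punchInᵢ≢i; splitAt⁻¹-↑ˡ; splitAt⁻¹-↑ʳ )
open import Data.List using (List; []; _∷_; _++_; map; allFin)
open import Data.List.Properties using (map-tabulate)
open import Data.List.Membership.Propositional.Properties using (∈-allFin)
open import Data.List.Relation.Unary.Any as Any using (satisfied)
open import Data.List.Relation.Unary.Any.Properties using (any⁺; any⁻)
open import Data.Maybe using (just; nothing)
open import Data.Product using (_×_; Σ; ∃; _,_; proj₁; proj₂)
open import Data.Sum using (_⊎_; inj₁; inj₂)
open import Data.Empty using (⊥-elim)
import Data.Integer as ℤ
open import Data.Rational using (ℚ; 0ℚ; mkℚ; -_; *≤*; *<*)
  renaming (_+_ to _+ℚ_; _-_ to _-ℚ_; _≤_ to _≤ℚ_; _<_ to _<ℚ_)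
import Data.Rational.Properties as ℚ
open import Data.Nat.Coprimality using (1-coprimeTo)
open import Function.Bundles using (mk⇔)
open import Function.Definitions using (Injective)
open import Relation.Binary.PropositionalEquality
open import Relation.Binary.Definitions using (tri<; tri≈; tri>)
open import Relation.Nullary using (yes; no)

true≢false : true ≢ false
true≢false ()

true⊎false : ∀ b → (b ≡ true) ⊎ (b ≡ false)
true⊎false true  = inj₁ refl
true⊎false false = inj₂ refl

T⇒≡true : ∀ {b} → T b → b ≡ true
T⇒≡true {true} _ = refl

≡true⇒T : ∀ {b} → b ≡ true → T b
≡true⇒T refl = _

∨-introˡ : ∀ {a} b → a ≡ true → (a ∨ b) ≡ true
∨-introˡ b refl = refl

∨-introʳ : ∀ a {b} → b ≡ true → (a ∨ b) ≡ true
∨-introʳ true  refl = refl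
∨-introʳ false refl = refl

∨-elim : ∀ a {b} → (a ∨ b) ≡ true → (a ≡ true) ⊎ (b ≡ true)
∨-elim true  _ = inj₁ refl
∨-elim false e = inj₂ e

∧-intro : ∀ {a b} → a ≡ true → b ≡ true → (a ∧ b) ≡ true
∧-intro refl refl = refl

∧-elimˡ : ∀ a {b} → (a ∧ b) ≡ true → a ≡ true
∧-elimˡ true _ = refl

∧-elimʳ : ∀ a {b} → (a ∧ b) ≡ true → b ≡ true
∧-elimʳ true e = e

not-intro : ∀ {b} → b ≡ false → not b ≡ true
not-intro refl = refl

not-elim : ∀ {b} → not b ≡ true → b ≡ false
not-elim {false} _ = refl

==F⇒≡ : ∀ {n} {p q : Fin n} → (p ==F q) ≡ true → p ≡ q
==F⇒≡ {p = p} {q} e with p ≟ q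
... | yes p≡q = p≡q

==F-refl : ∀ {n} (p : Fin n) → (p ==F p) ≡ true
==F-refl p with p ≟ p
... | yes _ = refl
... | no p≢p = ⊥-elim (p≢p refl)

≢⇒==F-false : ∀ {n} {p q : Fin n} → p ≢ q → (p ==F q) ≡ false
≢⇒==F-false {p = p} {q} p≢q with p ≟ q
... | yes p≡q = ⊥-elim (p≢q p≡q)
... | no _ = refl

any-allFin-intro : ∀ {n} (f : Fin n → Bool) i → f i ≡ true → any f (allFin n) ≡ true
any-allFin-intro f i e = T⇒≡true (any⁺ f (Any.map (λ { refl → ≡true⇒T e }) (∈-allFin i)))

any-allFin-elim : ∀ {n} (f : Fin n → Bool) → any f (allFin n) ≡ true → ∃ λ i → f i ≡ true
any-allFin-elim {n} f e with satisfied (any⁻ f (allFin n) (≡true⇒T e))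
... | i , fi = i , T⇒≡true fi

any-allFin-false : ∀ {n} (f : Fin n → Bool) → (∀ i → f i ≡ false) → any f (allFin n) ≡ false
any-allFin-false f none with true⊎false (any f (allFin _))
... | inj₂ e = e
... | inj₁ e with any-allFin-elim f e
...   | i , fi = ⊥-elim (true≢false (trans (sym fi) (none i)))

<ᵇ-true : ∀ {m n} → m < n → (m <ᵇ n) ≡ true
<ᵇ-true m<n = T⇒≡true (<⇒<ᵇ m<n)

<ᵇ-false : ∀ {m n} → n ≤ m → (m <ᵇ n) ≡ false
<ᵇ-false {m} {n} n≤m with true⊎false (m <ᵇ n)
... | inj₁ m<n  = ⊥-elim (<-irrefl refl (≤-trans (<ᵇ⇒< m n (≡true⇒T m<n)) n≤m))
... | inj₂ m≮n = m≮n

-- Walks and distances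

module Walks {n : ℕ} (G : Graph n) where

  within-refl : ∀ p → within G 0 p p ≡ true
  within-refl = ==F-refl

  within-0⇒≡ : ∀ {p q} → within G 0 p q ≡ true → p ≡ q
  within-0⇒≡ = ==F⇒≡

  within-weaken : ∀ k {p q} → within G k p q ≡ true → within G (suc k) p q ≡ true
  within-weaken k = ∨-introˡ _

  within-step : ∀ k {p w q} → G p w ≡ true → within G k w q ≡ true → within G (suc k) p q ≡ true
  within-step k {p} {w} pw wq = ∨-introʳ _ (any-allFin-intro _ w (∧-intro pw wq))

  within-view : ∀ k {p q} → within G (suc k) p q ≡ true →
                (within G k p q ≡ true) ⊎ (∃ λ w → (G p w ≡ true) × (within G k w q ≡ true))
  within-view k {p} {q} e with ∨-elim (within G k p q) e
  ... | inj₁ short = inj₁ short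
  ... | inj₂ step with any-allFin-elim _ step
  ...   | w , e' = inj₂ (w , ∧-elimˡ _ e' , ∧-elimʳ (G p w) e')

  within-mono : ∀ {k m p q} → k ≤ m → within G k p q ≡ true → within G m p q ≡ true
  within-mono {zero}  {zero}  z≤n e = e
  within-mono {zero}  {suc m} z≤n e = within-weaken m (within-mono {zero} {m} z≤n e)
  within-mono {suc k} {suc m} (s≤s k≤m) e with within-view k e
  ... | inj₁ short         = within-weaken m (within-mono k≤m short)
  ... | inj₂ (w , pw , wq) = within-step m pw (within-mono k≤m wq)

  within-edge : ∀ {p q} → G p q ≡ true → within G 1 p q ≡ true
  within-edge {q = q} pq = within-step 0 pq (within-refl q)

  within-trans : ∀ k m {p r q} → within G k p r ≡ true → within G m r q ≡ true → within G (k + m) p q ≡ true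
  within-trans zero    m {p} {r} {q} pr rq = subst (λ z → within G m z q ≡ true) (sym (within-0⇒≡ {p} {r} pr)) rq
  within-trans (suc k) m pr rq with within-view k pr
  ... | inj₁ short         = within-weaken (k + m) (within-trans k m short rq)
  ... | inj₂ (w , pw , wr) = within-step (k + m) pw (within-trans k m wr rq)

  within-snoc : ∀ k {p w q} → within G k p w ≡ true → G w q ≡ true → within G (suc k) p q ≡ true
  within-snoc k {p} {q = q} pw wq =
    subst (λ z → within G z p q ≡ true) (+-comm k 1) (within-trans k 1 pw (within-edge wq))

  within-sym : (∀ p q → G p q ≡ G q p) → ∀ k {p q} → within G k p q ≡ true → within G k q p ≡ true
  within-sym sym-G zero    {p} {q} e = subst (λ z → within G 0 z p ≡ true) (within-0⇒≡ {p} {q} e) (within-refl p)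
  within-sym sym-G (suc k) e with within-view k e
  ... | inj₁ short         = within-weaken k (within-sym sym-G k short)
  ... | inj₂ (w , pw , wq) = within-snoc k (within-sym sym-G k wq) (trans (sym-G _ _) pw)

  potential-≤-walk : (φ : Fin n → ℕ) → (∀ p w → G p w ≡ true → φ w ≤ suc (φ p)) →
                     ∀ k {p q} → within G k p q ≡ true → φ q ≤ φ p + k
  potential-≤-walk φ lip zero {p} e =
    subst (λ z → φ z ≤ φ p + 0) (within-0⇒≡ {p} e) (≤-reflexive (sym (+-identityʳ (φ p))))
  potential-≤-walk φ lip (suc k) {p} e with within-view k e
  ... | inj₁ short = ≤-trans (potential-≤-walk φ lip k short)
                             (≤-trans (n≤1+n _) (≤-reflexive (sym (+-suc (φ p) k))))
  ... | inj₂ (w , pw , wq) = ≤-trans (potential-≤-walk φ lip k wq)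
                             (≤-trans (+-monoˡ-≤ k (lip p w pw)) (≤-reflexive (sym (+-suc (φ p) k))))

  within-path : (f : ℕ → Fin n) (L : ℕ) → (∀ i → i < L → G (f i) (f (suc i)) ≡ true) →
                ∀ m i → i + m ≤ L → within G m (f i) (f (i + m)) ≡ true
  within-path f L edge zero i _ =
    subst (λ z → within G 0 (f i) (f z) ≡ true) (sym (+-identityʳ i)) (within-refl (f i))
  within-path f L edge (suc m) i i+1+m≤L =
    subst (λ z → within G (suc m) (f i) (f z) ≡ true) (sym (+-suc i m))
      (within-step m (edge i (≤-trans (s≤s (m≤m+n i m)) 1+i+m≤L))
        (within-path f L edge m (suc i) 1+i+m≤L))
    where
      1+i+m≤L : suc i + m ≤ L
      1+i+m≤L = ≤-trans (≤-reflexive (sym (+-suc i m))) i+1+m≤L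

IsContraction : ∀ {m n} → Graph m → Graph n → (Fin m → Fin n) → Set
IsContraction {m} H K f = ∀ (i j : Fin m) → H i j ≡ true → (K (f i) (f j) ≡ true) ⊎ (f i ≡ f j)

within-map : ∀ {m n} (H : Graph m) (K : Graph n) (f : Fin m → Fin n) → IsContraction H K f →
             ∀ k {p q} → within H k p q ≡ true → within K k (f p) (f q) ≡ true
within-map H K f contr zero {p} e =
  subst (λ z → within K 0 (f p) (f z) ≡ true) (Walks.within-0⇒≡ H {p} e) (Walks.within-refl K (f p))
within-map H K f contr (suc k) e with Walks.within-view H k e
... | inj₁ short = Walks.within-weaken K k (within-map H K f contr k short)
... | inj₂ (w , pw , wq) with contr _ w pw
...   | inj₁ edge  = Walks.within-step K k edge (within-map H K f contr k wq)
...   | inj₂ fp≡fw rewrite fp≡fw = Walks.within-weaken K k (within-map H K f contr k wq)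

firstFrom-sound : ∀ (P : ℕ → Bool) f i {d} → firstFrom P f i ≡ just d →
                  (P d ≡ true) × (∀ k → i ≤ k → k < d → P k ≡ false)
firstFrom-sound P zero i ()
firstFrom-sound P (suc f) i e with P i in Pi
firstFrom-sound P (suc f) i refl | true = Pi , λ k i≤k k<i → ⊥-elim (<-irrefl refl (<-≤-trans k<i i≤k))
firstFrom-sound P (suc f) i {d} e | false with firstFrom-sound P f (suc i) e
... | Pd , later = Pd , earlier
  where
    earlier : ∀ k → i ≤ k → k < d → P k ≡ false
    earlier k i≤k k<d with m≤n⇒m<n∨m≡n i≤k
    ... | inj₁ i<k  = later k i<k k<d
    ... | inj₂ refl = Pi

firstFrom-complete : ∀ (P : ℕ → Bool) f i k → P k ≡ true → i ≤ k → k < i + f →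
                     ∃ λ d → (firstFrom P f i ≡ just d) × (d ≤ k)
firstFrom-complete P zero i k Pk i≤k k<i+0 =
  ⊥-elim (<-irrefl refl (<-≤-trans k<i+0 (≤-trans (≤-reflexive (+-identityʳ i)) i≤k)))
firstFrom-complete P (suc f) i k Pk i≤k k<i+f with P i in Pi
... | true = i , refl , i≤k
... | false with m≤n⇒m<n∨m≡n i≤k
...   | inj₁ i<k  = firstFrom-complete P f (suc i) k Pk i<k (≤-trans k<i+f (≤-reflexive (+-suc i f)))
...   | inj₂ refl = ⊥-elim (true≢false (trans (sym Pk) Pi))

firstFrom-cong : ∀ (P Q : ℕ → Bool) → (∀ k → P k ≡ Q k) → ∀ f i → firstFrom P f i ≡ firstFrom Q f i
firstFrom-cong P Q P≗Q zero    i = refl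
firstFrom-cong P Q P≗Q (suc f) i rewrite P≗Q i with Q i
... | true  = refl
... | false = firstFrom-cong P Q P≗Q f (suc i)

count : ∀ m → (Fin m → Bool) → ℕ
count zero    f = 0
count (suc m) f = (if f zero then 1 else 0) + count m (λ i → f (suc i))

count-≤ : ∀ m f → count m f ≤ m
count-≤ zero    f = z≤n
count-≤ (suc m) f with f zero
... | true  = s≤s (count-≤ m _)
... | false = ≤-trans (count-≤ m _) (n≤1+n m)

count-mono : ∀ m f g → (∀ i → f i ≡ true → g i ≡ true) → count m f ≤ count m g
count-mono zero    f g f⊆g = z≤n
count-mono (suc m) f g f⊆g with f zero in f0 | g zero in g0
... | true  | true  = s≤s (count-mono m _ _ (λ i → f⊆g (suc i)))
... | true  | false = ⊥-elim (true≢false (trans (sym (f⊆g zero f0)) g0))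
... | false | true  = ≤-trans (count-mono m _ _ (λ i → f⊆g (suc i))) (n≤1+n _)
... | false | false = count-mono m _ _ (λ i → f⊆g (suc i))

count-strict : ∀ m f g → (∀ i → f i ≡ true → g i ≡ true) →
               ∀ j → g j ≡ true → f j ≡ false → count m f < count m g
count-strict (suc m) f g f⊆g zero gj fj rewrite gj | fj = s≤s (count-mono m _ _ (λ i → f⊆g (suc i)))
count-strict (suc m) f g f⊆g (suc j) gj fj with f zero in f0 | g zero in g0
... | true  | true  = s≤s (count-strict m _ _ (λ i → f⊆g (suc i)) j gj fj)
... | true  | false = ⊥-elim (true≢false (trans (sym (f⊆g zero f0)) g0))
... | false | true  = ≤-trans (count-strict m _ _ (λ i → f⊆g (suc i)) j gj fj) (n≤1+n _)
... | false | false = count-strict m _ _ (λ i → f⊆g (suc i)) j gj fj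

count-pos : ∀ m f j → f j ≡ true → 1 ≤ count m f
count-pos (suc m) f zero    fj rewrite fj = s≤s z≤n
count-pos (suc m) f (suc j) fj with f zero
... | true  = s≤s z≤n
... | false = count-pos m _ j fj

module Distance {n : ℕ} (G : Graph n) where
  open Walks G

  dist-within : ∀ {p q d} → dist G p q ≡ just d → within G d p q ≡ true
  dist-within e = proj₁ (firstFrom-sound _ (suc n) 0 e)

  dist-minimal : ∀ {p q d k} → dist G p q ≡ just d → within G k p q ≡ true → d ≤ k
  dist-minimal {d = d} {k} e walk with d ≤? k
  ... | yes d≤k = d≤k
  ... | no d≰k = ⊥-elim (true≢false (trans (sym walk) (proj₂ (firstFrom-sound _ (suc n) 0 e) k z≤n (≰⇒> d≰k))))

  dist-pos : ∀ {p q d} → p ≢ q → dist G p q ≡ just d → 1 ≤ d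
  dist-pos {d = zero}  p≢q e = ⊥-elim (p≢q (within-0⇒≡ (dist-within e)))
  dist-pos {d = suc d} p≢q e = s≤s z≤n

  -- The balls of radius m around q grow strictly until they stop growing for good,
  -- and they can grow at most n times: so no walk needs more than n steps.
  module _ (q : Fin n) where
    private
      Ball : ℕ → Fin n → Bool
      Ball m p = within G m p q

      Stable : ℕ → Set
      Stable m = ∀ p → Ball (suc m) p ≡ true → Ball m p ≡ true

      stable-suc : ∀ m → Stable m → Stable (suc m)
      stable-suc m st p e with within-view (suc m) e
      ... | inj₁ short         = short
      ... | inj₂ (w , pw , wq) = within-step m pw (st w wq)

      stable-+ : ∀ m → Stable m → ∀ j p → Ball (j + m) p ≡ true → Ball m p ≡ true
      stable-+ m st zero    p e = e
      stable-+ m st (suc j) p e = stable-+ m st j p (stable-later j p e)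
        where
          stable-later : ∀ j → Stable (j + m)
          stable-later zero    = st
          stable-later (suc j) = stable-suc (j + m) (stable-later j)

      grows-or-stable : ∀ m → (suc m ≤ count n (Ball m)) ⊎ (∃ λ m' → (m' < m) × Stable m')
      grows-or-stable zero = inj₁ (count-pos n (Ball 0) q (within-refl q))
      grows-or-stable (suc m) with grows-or-stable m
      ... | inj₂ (m' , m'<m , st) = inj₂ (m' , ≤-trans m'<m (n≤1+n m) , st)
      ... | inj₁ grown with any (λ p → Ball (suc m) p ∧ not (Ball m p)) (allFin n) in new
      ...   | true with any-allFin-elim _ new
      ...     | p , ep = inj₁ (≤-trans (s≤s grown)
                  (count-strict n (Ball m) (Ball (suc m)) (λ i → within-weaken m) p
                    (∧-elimˡ (Ball (suc m) p) ep) (not-elim (∧-elimʳ (Ball (suc m) p) ep))))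
      grows-or-stable (suc m) | inj₁ grown | false = inj₂ (m , ≤-refl , stable)
        where
          stable : Stable m
          stable p e with true⊎false (Ball m p)
          ... | inj₁ old = old
          ... | inj₂ fresh = ⊥-elim (true≢false (trans
                  (sym (any-allFin-intro _ p (∧-intro e (not-intro fresh)))) new))

    within-shorten : ∀ k p → within G k p q ≡ true → within G n p q ≡ true
    within-shorten k p e with k ≤? n
    ... | yes k≤n = within-mono k≤n e
    ... | no k≰n with grows-or-stable n
    ...   | inj₁ grown = ⊥-elim (<-irrefl refl (≤-trans grown (count-≤ n (Ball n))))
    ...   | inj₂ (m' , m'<n , st) =
            within-mono (<⇒≤ m'<n) (stable-+ m' st (k ∸ m') p
              (subst (λ z → Ball z p ≡ true) (sym (m∸n+n≡m (≤-trans (<⇒≤ m'<n) (<⇒≤ (≰⇒> k≰n))))) e))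

  dist-defined : ∀ {p q k} → within G k p q ≡ true → ∃ λ d → (dist G p q ≡ just d) × (d ≤ k)
  dist-defined {p} {q} {k} e with k ≤? n
  ... | yes k≤n = firstFrom-complete _ (suc n) 0 k e z≤n (s≤s k≤n)
  ... | no k≰n with firstFrom-complete _ (suc n) 0 n (within-shorten q k p e) z≤n ≤-refl
  ...   | d , de , d≤n = d , de , ≤-trans d≤n (<⇒≤ (≰⇒> k≰n))

  dist-sym : (∀ p q → G p q ≡ G q p) → ∀ p q → dist G p q ≡ dist G q p
  dist-sym sym-G p q = firstFrom-cong _ _ within-comm (suc n) 0
    where
      within-comm : ∀ k → within G k p q ≡ within G k q p
      within-comm k = ⇔→≡ (mk⇔ (within-sym sym-G k) (within-sym sym-G k))

module Metric {n : ℕ} (G : Graph n) (connected : Connected G) where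
  open Walks G
  open Distance G

  private
    shortest : ∀ p q → ∃ λ d → (dist G p q ≡ just d) × (d ≤ proj₁ (connected p q))
    shortest p q = dist-defined {p} {q} (T⇒≡true (proj₂ (connected p q)))

  d : Fin n → Fin n → ℕ
  d p q = proj₁ (shortest p q)

  d-dist : ∀ p q → dist G p q ≡ just (d p q)
  d-dist p q = proj₁ (proj₂ (shortest p q))

  d-walk : ∀ p q → within G (d p q) p q ≡ true
  d-walk p q = dist-within (d-dist p q)

  d-minimal : ∀ {p q k} → within G k p q ≡ true → d p q ≤ k
  d-minimal {p} {q} = dist-minimal (d-dist p q)

  d-self : ∀ p → d p p ≡ 0
  d-self p = n≤0⇒n≡0 (d-minimal {p} {p} {0} (within-refl p))

  d-pos : ∀ {p q} → p ≢ q → 1 ≤ d p q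
  d-pos {p} {q} p≢q = dist-pos p≢q (d-dist p q)

  d-lipschitz : ∀ y {i j} → G i j ≡ true → d y j ≤ suc (d y i)
  d-lipschitz y {i} {j} ij = d-minimal {y} {j} (within-snoc (d y i) (d-walk y i) ij)

-- Reciprocals and finite sums of rationals

recipℕ : ℕ → ℚ
recipℕ n = recipDist (just n)

recipℕ-suc : ∀ d → recipℕ (suc d) ≡ mkℚ (ℤ.+ 1) d (1-coprimeTo (suc d))
recipℕ-suc d = ℚ.normalize-coprime (1-coprimeTo (suc d))

recipℕ-antitone : ∀ {a b} → 1 ≤ a → a ≤ b → recipℕ b ≤ℚ recipℕ a
recipℕ-antitone {suc a} {suc b} _ (s≤s a≤b) rewrite recipℕ-suc a | recipℕ-suc b =
  *≤* (ℤ.+≤+ (subst₂ _≤_ (sym (+-identityʳ (suc a))) (sym (+-identityʳ (suc b))) (s≤s a≤b)))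

recipℕ-strict : ∀ {a} → 1 ≤ a → recipℕ (suc a) <ℚ recipℕ a
recipℕ-strict {suc a} _ rewrite recipℕ-suc a | recipℕ-suc (suc a) =
  *<* (ℤ.+<+ (subst₂ _<_ (sym (+-identityʳ (suc a))) (sym (+-identityʳ (suc (suc a)))) ≤-refl))

recipℕ-nonneg : ∀ a → 0ℚ ≤ℚ recipℕ a
recipℕ-nonneg zero    = ℚ.≤-refl
recipℕ-nonneg (suc a) rewrite recipℕ-suc a = *≤* (ℤ.+≤+ z≤n)

recipDist-nonneg : ∀ m → 0ℚ ≤ℚ recipDist m
recipDist-nonneg nothing  = ℚ.≤-refl
recipDist-nonneg (just a) = recipℕ-nonneg a

module _ {n : ℕ} (G : Graph n) where
  open Distance G

  recipDist-≤-of-walks : ∀ {p q} L → 1 ≤ L → (∀ k → within G k p q ≡ true → L ≤ k) →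
                         recipDist (dist G p q) ≤ℚ recipℕ L
  recipDist-≤-of-walks {p} {q} L 1≤L long with dist G p q in e
  ... | nothing = recipℕ-nonneg L
  ... | just d  = recipℕ-antitone 1≤L (long d (dist-within e))

  recipℕ-≤-recipDist : ∀ {p q} k → p ≢ q → within G k p q ≡ true → recipℕ k ≤ℚ recipDist (dist G p q)
  recipℕ-≤-recipDist {p} {q} k p≢q walk with dist-defined {p} {q} {k} walk
  ... | d , e , d≤k rewrite e = recipℕ-antitone (dist-pos p≢q e) d≤k

recipDist-contraction : ∀ {n} (H K : Graph n) (f : Fin n → Fin n) → IsContraction H K f →
                        ∀ {p q} → f p ≡ p → f q ≡ q → p ≢ q → recipDist (dist H p q) ≤ℚ recipDist (dist K p q)
recipDist-contraction H K f contr {p} {q} fp fq p≢q with dist H p q in e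
... | nothing = recipDist-nonneg (dist K p q)
... | just d  = recipℕ-≤-recipDist K d p≢q
                  (subst₂ (λ x y → within K d x y ≡ true) fp fq (within-map H K f contr d (Distance.dist-within H e)))

sumOver : ∀ {A : Set} → List A → (A → ℚ) → ℚ
sumOver xs f = sumℚ (map f xs)

module _ {A : Set} where

  sumOver-cong : ∀ (xs : List A) {f g} → (∀ x → f x ≡ g x) → sumOver xs f ≡ sumOver xs g
  sumOver-cong []       f≗g = refl
  sumOver-cong (x ∷ xs) f≗g = cong₂ _+ℚ_ (f≗g x) (sumOver-cong xs f≗g)

  sumOver-mono : ∀ (xs : List A) {f g} → (∀ x → f x ≤ℚ g x) → sumOver xs f ≤ℚ sumOver xs g
  sumOver-mono []       f≤g = ℚ.≤-refl
  sumOver-mono (x ∷ xs) f≤g = ℚ.+-mono-≤ (f≤g x) (sumOver-mono xs f≤g)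

  sumOver-zero : ∀ (xs : List A) → sumOver xs (λ _ → 0ℚ) ≡ 0ℚ
  sumOver-zero []       = refl
  sumOver-zero (x ∷ xs) rewrite sumOver-zero xs = refl

  sumOver-nonneg : ∀ (xs : List A) f → (∀ x → 0ℚ ≤ℚ f x) → 0ℚ ≤ℚ sumOver xs f
  sumOver-nonneg xs f f≥0 = ℚ.≤-trans (ℚ.≤-reflexive (sym (sumOver-zero xs))) (sumOver-mono xs f≥0)

  +-interchange : ∀ a b c d → (a +ℚ b) +ℚ (c +ℚ d) ≡ (a +ℚ c) +ℚ (b +ℚ d)
  +-interchange a b c d = begin
    (a +ℚ b) +ℚ (c +ℚ d) ≡⟨ ℚ.+-assoc a b (c +ℚ d) ⟩
    a +ℚ (b +ℚ (c +ℚ d)) ≡⟨ cong (a +ℚ_) (sym (ℚ.+-assoc b c d)) ⟩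
    a +ℚ ((b +ℚ c) +ℚ d) ≡⟨ cong (λ z → a +ℚ (z +ℚ d)) (ℚ.+-comm b c) ⟩
    a +ℚ ((c +ℚ b) +ℚ d) ≡⟨ cong (a +ℚ_) (ℚ.+-assoc c b d) ⟩
    a +ℚ (c +ℚ (b +ℚ d)) ≡⟨ sym (ℚ.+-assoc a c (b +ℚ d)) ⟩
    (a +ℚ c) +ℚ (b +ℚ d) ∎
    where open ≡-Reasoning

  sumOver-+ : ∀ (xs : List A) f g → sumOver xs (λ x → f x +ℚ g x) ≡ sumOver xs f +ℚ sumOver xs g
  sumOver-+ []       f g = refl
  sumOver-+ (x ∷ xs) f g rewrite sumOver-+ xs f g = +-interchange (f x) (g x) (sumOver xs f) (sumOver xs g)

  sumOver-++ : ∀ (xs ys : List A) f → sumOver (xs ++ ys) f ≡ sumOver xs f +ℚ sumOver ys f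
  sumOver-++ []       ys f = sym (ℚ.+-identityˡ _)
  sumOver-++ (x ∷ xs) ys f rewrite sumOver-++ xs ys f = sym (ℚ.+-assoc (f x) (sumOver xs f) (sumOver ys f))

  sumOver-if : ∀ (xs : List A) (b : Bool) (f : A → ℚ) →
               sumOver xs (λ x → if b then f x else 0ℚ) ≡ (if b then sumOver xs f else 0ℚ)
  sumOver-if xs true  f = refl
  sumOver-if xs false f = sumOver-zero xs

sumOver-swap : ∀ {A B : Set} (xs : List A) (ys : List B) (F : A → B → ℚ) →
               sumOver xs (λ a → sumOver ys (F a)) ≡ sumOver ys (λ b → sumOver xs (λ a → F a b))
sumOver-swap []       ys F = sym (sumOver-zero ys)
sumOver-swap (x ∷ xs) ys F rewrite sumOver-swap xs ys F =
  sym (sumOver-+ ys (F x) (λ b → sumOver xs (λ a → F a b)))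

sumOver-allFin-suc : ∀ n f → sumOver (allFin (suc n)) f ≡ f zero +ℚ sumOver (allFin n) (λ i → f (suc i))
sumOver-allFin-suc n f = cong (λ xs → f zero +ℚ sumℚ xs)
  (trans (map-tabulate suc f) (sym (map-tabulate (λ i → i) (λ i → f (suc i)))))

sumOver-allFin-point : ∀ n (p : Fin n) c → sumOver (allFin n) (λ j → if j ==F p then c else 0ℚ) ≡ c
sumOver-allFin-point (suc n) zero c =
  trans (sumOver-allFin-suc n (λ j → if j ==F zero then c else 0ℚ))
        (trans (cong (c +ℚ_) (sumOver-zero (allFin n))) (ℚ.+-identityʳ c))
sumOver-allFin-point (suc n) (suc p) c =
  trans (sumOver-allFin-suc n (λ j → if j ==F suc p then c else 0ℚ))
        (trans (cong (0ℚ +ℚ_) (sumOver-allFin-point n p c)) (ℚ.+-identityˡ c))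

sumOver-allFin-pos : ∀ n (f : Fin n → ℚ) p → (∀ x → 0ℚ ≤ℚ f x) → 0ℚ <ℚ f p → 0ℚ <ℚ sumOver (allFin n) f
sumOver-allFin-pos n f p f≥0 fp>0 =
  ℚ.<-≤-trans fp>0 (ℚ.≤-trans (ℚ.≤-reflexive (sym (sumOver-allFin-point n p (f p))))
    (sumOver-mono (allFin n) point≤f))
  where
    point≤f : ∀ x → (if x ==F p then f p else 0ℚ) ≤ℚ f x
    point≤f x with true⊎false (x ==F p)
    ... | inj₁ x≡p rewrite x≡p | ==F⇒≡ {p = x} x≡p = ℚ.≤-refl
    ... | inj₂ x≢p rewrite x≢p = f≥0 x

range : ℕ → List ℕ
range zero    = []
range (suc n) = range n ++ (n ∷ [])

sumOver-range-suc : ∀ n f → sumOver (range (suc n)) f ≡ sumOver (range n) f +ℚ f n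
sumOver-range-suc n f =
  trans (sumOver-++ (range n) (n ∷ []) f) (cong (sumOver (range n) f +ℚ_) (ℚ.+-identityʳ (f n)))

restrict : ∀ {A : Set} → (A → Bool) → (A → ℚ) → A → ℚ
restrict P h x = if P x then h x else 0ℚ

sumOver-range-none : ∀ n (P : ℕ → Bool) h → (∀ m → m < n → P m ≡ false) → sumOver (range n) (restrict P h) ≡ 0ℚ
sumOver-range-none zero    P h none = refl
sumOver-range-none (suc n) P h none
  rewrite sumOver-range-suc n (restrict P h)
        | sumOver-range-none n P h (λ m m<n → none m (≤-trans m<n (n≤1+n n)))
        | none n ≤-refl = ℚ.+-identityˡ 0ℚ

others-false : ∀ n (P : ℕ → Bool) m₀ → (∀ m → m < n → P m ≡ true → m ≡ m₀) →
               ∀ m → m < n → m ≢ m₀ → P m ≡ false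
others-false n P m₀ unique m m<n m≢m₀ with true⊎false (P m)
... | inj₁ Pm  = ⊥-elim (m≢m₀ (unique m m<n Pm))
... | inj₂ ¬Pm = ¬Pm

sumOver-range-unique : ∀ n (P : ℕ → Bool) h m₀ → m₀ < n → P m₀ ≡ true →
                       (∀ m → m < n → P m ≡ true → m ≡ m₀) → sumOver (range n) (restrict P h) ≡ h m₀
sumOver-range-unique (suc n) P h m₀ m₀<1+n Pm₀ unique
  rewrite sumOver-range-suc n (restrict P h) with m≤n⇒m<n∨m≡n (≤-pred m₀<1+n)
... | inj₁ m₀<n
  rewrite sumOver-range-unique n P h m₀ m₀<n Pm₀ (λ m m<n → unique m (≤-trans m<n (n≤1+n n)))
        | others-false (suc n) P m₀ unique n ≤-refl (λ n≡m₀ → <-irrefl (sym n≡m₀) m₀<n) = ℚ.+-identityʳ (h m₀)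
... | inj₂ refl
  rewrite Pm₀
        | sumOver-range-none n P h
            (λ m m<n → others-false (suc n) P n unique m (≤-trans m<n (n≤1+n n)) (<⇒≢ m<n)) =
  ℚ.+-identityˡ (h n)

search : ∀ n (P : ℕ → Bool) → (∃ λ m → (m < n) × (P m ≡ true)) ⊎ (∀ m → m < n → P m ≡ false)
search zero    P = inj₂ (λ m ())
search (suc n) P with search n P
... | inj₁ (m , m<n , Pm) = inj₁ (m , ≤-trans m<n (n≤1+n n) , Pm)
... | inj₂ none with true⊎false (P n)
...   | inj₁ Pn  = inj₁ (n , ≤-refl , Pn)
...   | inj₂ ¬Pn = inj₂ below
  where
    below : ∀ m → m < suc n → P m ≡ false
    below m m<1+n with m≤n⇒m<n∨m≡n (≤-pred m<1+n)
    ... | inj₁ m<n  = none m m<n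
    ... | inj₂ refl = ¬Pn

sumOver-restrict-zero : ∀ {A : Set} (xs : List A) (P : A → Bool) h → (∀ x → h x ≡ 0ℚ) →
                        sumOver xs (restrict P h) ≡ 0ℚ
sumOver-restrict-zero xs P h h≡0 = trans (sumOver-cong xs restrict-0) (sumOver-zero xs)
  where
    restrict-0 : ∀ x → restrict P h x ≡ 0ℚ
    restrict-0 x with P x
    ... | true  = h≡0 x
    ... | false = refl

sumOver-restrict-nonneg : ∀ {A : Set} (xs : List A) (P : A → Bool) h → (∀ x → 0ℚ ≤ℚ h x) →
                          0ℚ ≤ℚ sumOver xs (restrict P h)
sumOver-restrict-nonneg xs P h h≥0 = sumOver-nonneg xs _ restrict-nonneg
  where
    restrict-nonneg : ∀ x → 0ℚ ≤ℚ restrict P h x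
    restrict-nonneg x with P x
    ... | true  = h≥0 x
    ... | false = ℚ.≤-refl

sumOver-allFin-hits : ∀ {A : Set} n (xs : List A) (pt : A → Fin n) (h : A → ℚ) →
                      sumOver (allFin n) (λ j → sumOver xs (restrict (λ m → j ==F pt m) h)) ≡ sumOver xs h
sumOver-allFin-hits n xs pt h =
  trans (sumOver-swap (allFin n) xs (λ j → restrict (λ m → j ==F pt m) h))
        (sumOver-cong xs (λ m → sumOver-allFin-point n (pt m) (h m)))

if-+ : ∀ (b : Bool) x y → (if b then x +ℚ y else 0ℚ) ≡ (if b then x else 0ℚ) +ℚ (if b then y else 0ℚ)
if-+ true  x y = refl
if-+ false x y = sym (ℚ.+-identityˡ 0ℚ)

≤-+-nonneg : ∀ {p q} → 0ℚ ≤ℚ q → p ≤ℚ p +ℚ q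
≤-+-nonneg {p} q≥0 = ℚ.≤-trans (ℚ.≤-reflexive (sym (ℚ.+-identityʳ p))) (ℚ.+-monoʳ-≤ p q≥0)

+-[-]-cancel : ∀ a b → b +ℚ (a -ℚ b) ≡ a
+-[-]-cancel a b = begin
  b +ℚ (a +ℚ - b) ≡⟨ cong (b +ℚ_) (ℚ.+-comm a (- b)) ⟩
  b +ℚ (- b +ℚ a) ≡⟨ sym (ℚ.+-assoc b (- b) a) ⟩
  (b +ℚ - b) +ℚ a ≡⟨ cong (_+ℚ a) (ℚ.+-inverseʳ b) ⟩
  0ℚ +ℚ a         ≡⟨ ℚ.+-identityˡ a ⟩
  a               ∎
  where open ≡-Reasoning

gain-≤ : ∀ {x y a b} → x ≤ℚ b → a ≤ℚ y → x +ℚ (a -ℚ b) ≤ℚ y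
gain-≤ {x} {y} {a} {b} x≤b a≤y =
  ℚ.≤-trans (ℚ.+-monoˡ-≤ (a -ℚ b) x≤b) (ℚ.≤-trans (ℚ.≤-reflexive (+-[-]-cancel a b)) a≤y)

loss-≤ : ∀ {x y a b} → x ≤ℚ a → b ≤ℚ y → x ≤ℚ y +ℚ (a -ℚ b)
loss-≤ {x} {y} {a} {b} x≤a b≤y =
  ℚ.≤-trans x≤a (ℚ.≤-trans (ℚ.≤-reflexive (sym (+-[-]-cancel a b))) (ℚ.+-monoˡ-≤ (a -ℚ b) b≤y))


->0 : ∀ {a b} → b <ℚ a → 0ℚ <ℚ a -ℚ b
->0 {a} {b} b<a = ℚ.≤-<-trans (ℚ.≤-reflexive (sym (ℚ.+-inverseʳ b))) (ℚ.+-monoˡ-< (- b) b<a)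

<-of-surplus : ∀ A B E P → A +ℚ (E +ℚ P) ≤ℚ B +ℚ E → 0ℚ <ℚ P → A <ℚ B
<-of-surplus A B E P ≤B+E P>0 = ℚ.<-≤-trans A<A+P A+P≤B
  where
    A<A+P : A <ℚ A +ℚ P
    A<A+P = ℚ.≤-<-trans (ℚ.≤-reflexive (sym (ℚ.+-identityʳ A))) (ℚ.+-monoʳ-< A P>0)
    A+P≤B : A +ℚ P ≤ℚ B
    A+P≤B with B ℚ.<? A +ℚ P
    ... | no B≮A+P = ℚ.≮⇒≥ B≮A+P
    ... | yes B<A+P = ⊥-elim (ℚ.<-irrefl refl (ℚ.<-≤-trans (ℚ.+-monoˡ-< E B<A+P)
                        (ℚ.≤-trans (ℚ.≤-reflexive (trans (ℚ.+-assoc A P E) (cong (A +ℚ_) (ℚ.+-comm P E)))) ≤B+E)))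

-- The glued graph

imgAdj-intro : ∀ {m n} (f : Fin m → Fin n) (H : Graph m) i j → H i j ≡ true → imgAdj f H (f i) (f j) ≡ true
imgAdj-intro f H i j Hij =
  any-allFin-intro _ i (any-allFin-intro _ j (∧-intro Hij (∧-intro (==F-refl (f i)) (==F-refl (f j)))))

imgAdj-elim : ∀ {m n} (f : Fin m → Fin n) (H : Graph m) p q → imgAdj f H p q ≡ true →
              ∃ λ i → ∃ λ j → (H i j ≡ true) × (f i ≡ p) × (f j ≡ q)
imgAdj-elim f H p q e with any-allFin-elim _ e
... | i , ei with any-allFin-elim _ ei
...   | j , ej = i , j , ∧-elimˡ _ ej , ==F⇒≡ (∧-elimˡ _ (∧-elimʳ (H i j) ej))
                 , ==F⇒≡ (∧-elimʳ (f i ==F p) (∧-elimʳ (H i j) ej))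

imgAdj-sym : ∀ {m n} (f : Fin m → Fin n) (H : Graph m) → (∀ i j → H i j ≡ H j i) →
             ∀ p q → imgAdj f H p q ≡ imgAdj f H q p
imgAdj-sym f H sym-H p q = ⇔→≡ (mk⇔ (flip p q) (flip q p))
  where
    flip : ∀ p q → imgAdj f H p q ≡ true → imgAdj f H q p ≡ true
    flip p q e with imgAdj-elim f H p q e
    ... | i , j , Hij , refl , refl = imgAdj-intro f H j i (trans (sym-H j i) Hij)

-- The three parts of V(G) occupy the index ranges [0, a), [a, a + b) and [a + b, a + b + s').
module GluedVertices {a b s' : ℕ} (G1 : Graph a) (u v : Fin a) (G2 : Graph (suc b)) (x1 : Fin (suc b)) where
  open Glue {a} {b} {s'} G1 u v G2 x1 public

  toℕ-ι1 : ∀ i → toℕ (ι1 i) < a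
  toℕ-ι1 i = subst (_< a) (sym (toℕ-↑ˡ i (b + s'))) (toℕ<n i)

  ι2-cases : ∀ g → ((g ≡ x1) × (ι2 g ≡ ι1 u)) ⊎ (Σ (x1 ≢ g) λ x1≢g → ι2 g ≡ a ↑ʳ (punchOut x1≢g ↑ˡ s'))
  ι2-cases g with x1 ≟ g
  ... | yes x1≡g = inj₁ (sym x1≡g , refl)
  ... | no x1≢g  = inj₂ (x1≢g , refl)

  toℕ-ι2 : ∀ g → x1 ≢ g → (a ≤ toℕ (ι2 g)) × (toℕ (ι2 g) < a + b)
  toℕ-ι2 g x1≢g with ι2-cases g
  ... | inj₁ (g≡x1 , _) = ⊥-elim (x1≢g (sym g≡x1))
  ... | inj₂ (x1≢g′ , e) rewrite e | toℕ-↑ʳ a (punchOut x1≢g′ ↑ˡ s') | toℕ-↑ˡ (punchOut x1≢g′) s' =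
    m≤m+n a _ , +-monoʳ-< a (toℕ<n (punchOut x1≢g′))

  toℕ-ι3 : ∀ (j : Fin s') → a + b ≤ toℕ (ι3 (suc j))
  toℕ-ι3 j rewrite toℕ-↑ʳ a (b ↑ʳ j) | toℕ-↑ʳ b j | sym (+-assoc a b (toℕ j)) = m≤m+n (a + b) (toℕ j)

  toℕ-≢ : ∀ {p q : Fin N} → toℕ p < toℕ q → p ≢ q
  toℕ-≢ p<q refl = <-irrefl refl p<q

  ι1≢ι2 : ∀ i g → x1 ≢ g → ι1 i ≢ ι2 g
  ι1≢ι2 i g x1≢g = toℕ-≢ (<-≤-trans (toℕ-ι1 i) (proj₁ (toℕ-ι2 g x1≢g)))

  ι1≢ι3 : ∀ i j → ι1 i ≢ ι3 (suc j)
  ι1≢ι3 i j = toℕ-≢ (<-≤-trans (toℕ-ι1 i) (≤-trans (m≤m+n a b) (toℕ-ι3 j)))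

  ι2≢ι3 : ∀ g j → x1 ≢ g → ι2 g ≢ ι3 (suc j)
  ι2≢ι3 g j x1≢g = toℕ-≢ (<-≤-trans (proj₂ (toℕ-ι2 g x1≢g)) (toℕ-ι3 j))

  ι1-injective : ∀ {i j} → ι1 i ≡ ι1 j → i ≡ j
  ι1-injective {i} {j} = ↑ˡ-injective (b + s') i j

  ι2-injective : ∀ {g h} → ι2 g ≡ ι2 h → g ≡ h
  ι2-injective {g} {h} e with ι2-cases g | ι2-cases h
  ... | inj₁ (g≡x1 , _)  | inj₁ (h≡x1 , _)  = trans g≡x1 (sym h≡x1)
  ... | inj₁ (_ , eg)    | inj₂ (x1≢h , _)  = ⊥-elim (ι1≢ι2 u h x1≢h (trans (sym eg) e))
  ... | inj₂ (x1≢g , _)  | inj₁ (_ , eh)    = ⊥-elim (ι1≢ι2 u g x1≢g (sym (trans e eh)))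
  ... | inj₂ (x1≢g , eg) | inj₂ (x1≢h , eh) =
    punchOut-injective x1≢g x1≢h (↑ˡ-injective s' _ _ (↑ʳ-injective a _ _ (trans (sym eg) (trans e eh))))

  ι3-injective : ∀ {c d} → ι3 c ≡ ι3 d → c ≡ d
  ι3-injective {zero}  {zero}  e = refl
  ι3-injective {zero}  {suc d} e = ⊥-elim (ι1≢ι3 v d e)
  ι3-injective {suc c} {zero}  e = ⊥-elim (ι1≢ι3 v c (sym e))
  ι3-injective {suc c} {suc d} e = cong suc (↑ʳ-injective b _ _ (↑ʳ-injective a _ _ e))

  ι2≡ι1 : ∀ {g i} → ι2 g ≡ ι1 i → (g ≡ x1) × (i ≡ u)
  ι2≡ι1 {g} {i} e with ι2-cases g
  ... | inj₁ (g≡x1 , eg) = g≡x1 , ι1-injective (trans (sym e) eg)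
  ... | inj₂ (x1≢g , _)  = ⊥-elim (ι1≢ι2 i g x1≢g (sym e))

  ι3≡ι1 : ∀ {c i} → ι3 c ≡ ι1 i → (c ≡ zero) × (i ≡ v)
  ι3≡ι1 {zero}      e = refl , ι1-injective (sym e)
  ι3≡ι1 {suc j} {i} e = ⊥-elim (ι1≢ι3 i j (sym e))

  ι2-x1 : ι2 x1 ≡ ι1 u
  ι2-x1 with ι2-cases x1
  ... | inj₁ (_ , e)       = e
  ... | inj₂ (x1≢x1 , _)   = ⊥-elim (x1≢x1 refl)

  data Location (p : Fin N) : Set where
    at₁ : ∀ i → p ≡ ι1 i → Location p
    at₂ : ∀ g → x1 ≢ g → p ≡ ι2 g → Location p
    at₃ : ∀ j → p ≡ ι3 (suc j) → Location p

  locate : ∀ p → Location p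
  locate p with splitAt a p in e₁
  ... | inj₁ i = at₁ i (sym (splitAt⁻¹-↑ˡ e₁))
  ... | inj₂ c with splitAt b c in e₂
  ...   | inj₂ j  = at₃ j (sym (trans (cong (a ↑ʳ_) (splitAt⁻¹-↑ʳ e₂)) (splitAt⁻¹-↑ʳ e₁)))
  ...   | inj₁ c′ = at₂ (punchIn x1 c′) (λ e → punchInᵢ≢i x1 c′ (sym e))
                        (sym (trans (ι2-punchIn c′) (trans (cong (a ↑ʳ_) (splitAt⁻¹-↑ˡ e₂)) (splitAt⁻¹-↑ʳ e₁))))
    where
      ι2-punchIn : ∀ c′ → ι2 (punchIn x1 c′) ≡ a ↑ʳ (c′ ↑ˡ s')
      ι2-punchIn c′ with x1 ≟ punchIn x1 c′
      ... | yes e = ⊥-elim (punchInᵢ≢i x1 c′ (sym e))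
      ... | no _  = cong (λ z → a ↑ʳ (z ↑ˡ s')) (trans (punchOut-cong x1 refl) (punchOut-punchIn x1))

  -- A function on V(G) given piecewise; its pieces only need to agree where ι2 x1 = ι1 u and ι3 zero = ι1 v.
  glue : ∀ {X : Set} → (Fin a → X) → (Fin (suc b) → X) → (Fin (suc s') → X) → Fin N → X
  glue f₁ f₂ f₃ p with locate p
  ... | at₁ i _   = f₁ i
  ... | at₂ g _ _ = f₂ g
  ... | at₃ j _   = f₃ (suc j)

  module _ {X : Set} (f₁ : Fin a → X) (f₂ : Fin (suc b) → X) (f₃ : Fin (suc s') → X) where

    glue-ι1 : ∀ i → glue f₁ f₂ f₃ (ι1 i) ≡ f₁ i
    glue-ι1 i with locate (ι1 i)
    ... | at₁ i′ e      = cong f₁ (sym (ι1-injective e))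
    ... | at₂ g x1≢g e  = ⊥-elim (ι1≢ι2 i g x1≢g e)
    ... | at₃ j e       = ⊥-elim (ι1≢ι3 i j e)

    glue-ι2 : ∀ g → x1 ≢ g → glue f₁ f₂ f₃ (ι2 g) ≡ f₂ g
    glue-ι2 g x1≢g with locate (ι2 g)
    ... | at₁ i e       = ⊥-elim (ι1≢ι2 i g x1≢g (sym e))
    ... | at₂ g′ _ e    = cong f₂ (sym (ι2-injective e))
    ... | at₃ j e       = ⊥-elim (ι2≢ι3 g j x1≢g e)

    glue-ι3-suc : ∀ j → glue f₁ f₂ f₃ (ι3 (suc j)) ≡ f₃ (suc j)
    glue-ι3-suc j with locate (ι3 (suc j))
    ... | at₁ i e       = ⊥-elim (ι1≢ι3 i j (sym e))
    ... | at₂ g x1≢g e  = ⊥-elim (ι2≢ι3 g j x1≢g (sym e))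
    ... | at₃ j′ e      = cong f₃ (sym (ι3-injective e))

    glue-ι2-all : f₁ u ≡ f₂ x1 → ∀ g → glue f₁ f₂ f₃ (ι2 g) ≡ f₂ g
    glue-ι2-all agree g with ι2-cases g
    ... | inj₁ (refl , e)  = trans (cong (glue f₁ f₂ f₃) e) (trans (glue-ι1 u) agree)
    ... | inj₂ (x1≢g , _)  = glue-ι2 g x1≢g

    glue-ι3 : f₁ v ≡ f₃ zero → ∀ c → glue f₁ f₂ f₃ (ι3 c) ≡ f₃ c
    glue-ι3 agree zero    = trans (glue-ι1 v) agree
    glue-ι3 agree (suc j) = glue-ι3-suc j

clamp : (n : ℕ) → ℕ → Fin (suc n)
clamp n       zero    = zero
clamp zero    (suc m) = zero
clamp (suc n) (suc m) = suc (clamp n m)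

toℕ-clamp : ∀ n m → m ≤ n → toℕ (clamp n m) ≡ m
toℕ-clamp n       zero    _         = refl
toℕ-clamp (suc n) (suc m) (s≤s m≤n) = cong suc (toℕ-clamp n m m≤n)

clamp-toℕ : ∀ n (c : Fin (suc n)) → clamp n (toℕ c) ≡ c
clamp-toℕ n       zero    = refl
clamp-toℕ (suc n) (suc c) = cong suc (clamp-toℕ n c)

inject₁-clamp : ∀ n m → m ≤ n → inject₁ (clamp n m) ≡ clamp (suc n) m
inject₁-clamp n       zero    _         = refl
inject₁-clamp (suc n) (suc m) (s≤s m≤n) = cong suc (inject₁-clamp n m m≤n)

clamp-self : ∀ n → clamp n n ≡ fromℕ n
clamp-self zero    = refl
clamp-self (suc n) = cong suc (clamp-self n)

pathGraph-clamp : ∀ n i → i < n → pathGraph (suc n) (clamp n i) (clamp n (suc i)) ≡ true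
pathGraph-clamp n i i<n = ∨-introˡ _ (T⇒≡true (≡⇒≡ᵇ _ _
  (trans (cong suc (toℕ-clamp n i (<⇒≤ i<n))) (sym (toℕ-clamp n (suc i) i<n)))))

pathGraph-lipschitz : ∀ n (c d : Fin n) → pathGraph n c d ≡ true → toℕ d ≤ suc (toℕ c)
pathGraph-lipschitz n c d e with ∨-elim (suc (toℕ c) ≡ᵇ toℕ d) e
... | inj₁ forward  = ≤-reflexive (sym (≡ᵇ⇒≡ (suc (toℕ c)) (toℕ d) (≡true⇒T forward)))
... | inj₂ backward = ≤-trans (n≤1+n (toℕ d))
                        (≤-trans (≤-reflexive (≡ᵇ⇒≡ (suc (toℕ d)) (toℕ c) (≡true⇒T backward))) (n≤1+n (toℕ c)))

pathGraph-sym : ∀ n (c d : Fin n) → pathGraph n c d ≡ pathGraph n d c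
pathGraph-sym n c d = ∨-comm (suc (toℕ c) ≡ᵇ toℕ d) (suc (toℕ d) ≡ᵇ toℕ c)

-- The transformation G ↦ G'

module Transformation
  (a b s' r k : ℕ) (G1 : Graph a) (G2 : Graph (suc b))
  (simple₁ : IsSimple G1) (simple₂ : IsSimple G2) (connected₁ : Connected G1) (connected₂ : Connected G2)
  (u v : Fin a) (uv : G1 u v ≡ true)
  (w : Fin k → Fin a) (k≥1 : 1 ≤ k)
  (N-u : ∀ y → ((G1 u y ≡ true × y ≢ v) → ∃ λ i → w i ≡ y) × ((∃ λ i → w i ≡ y) → (G1 u y ≡ true × y ≢ v)))
  (N-v : ∀ y → ((G1 v y ≡ true × y ≢ u) → ∃ λ i → w i ≡ y) × ((∃ λ i → w i ≡ y) → (G1 v y ≡ true × y ≢ u)))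
  (x : Fin (suc (suc r)) → Fin (suc b)) (x-injective : Injective _≡_ _≡_ x)
  (x-path : ∀ (i : Fin (suc r)) → G2 (x (inject₁ i)) (x (suc i)) ≡ true)
  (x-geodesic : dist G2 (x zero) (x (fromℕ (suc r))) ≡ just (suc r))
  (s+2≤t : suc s' + 2 ≤ suc (suc r))
  where

  open GluedVertices {a} {b} {s'} G1 u v G2 (x zero)
  open Modify {k} w (x (suc zero))

  x1 x2 : Fin (suc b)
  x1 = x zero
  x2 = x (suc zero)

  s : ℕ
  s = suc s'

  s≤r : s ≤ r
  s≤r = ≤-pred (≤-pred (subst (_≤ suc (suc r)) (+-comm s 2) s+2≤t))

  u≢v : u ≢ v
  u≢v refl = true≢false (trans (sym uv) (proj₂ simple₁ u))

  u-w : ∀ i → G1 u (w i) ≡ true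
  u-w i = proj₁ (proj₂ (N-u (w i)) (i , refl))

  w≢v : ∀ i → w i ≢ v
  w≢v i = proj₂ (proj₂ (N-u (w i)) (i , refl))

  w≢u : ∀ i → w i ≢ u
  w≢u i = proj₂ (proj₂ (N-v (w i)) (i , refl))

  N-u⊆w : ∀ y → G1 u y ≡ true → y ≢ v → ∃ λ i → w i ≡ y
  N-u⊆w y uy y≢v = proj₁ (N-u y) (uy , y≢v)

  N-v⊆w : ∀ y → G1 v y ≡ true → y ≢ u → ∃ λ i → w i ≡ y
  N-v⊆w y vy y≢u = proj₁ (N-v y) (vy , y≢u)

  sym₁ : ∀ i j → G1 i j ≡ G1 j i
  sym₁ = proj₁ simple₁

  sym₂ : ∀ g h → G2 g h ≡ G2 h g
  sym₂ = proj₁ simple₂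

  inW-w : ∀ i → inW (ι1 (w i)) ≡ true
  inW-w i = any-allFin-intro (λ m → ι1 (w m) ==F ι1 (w i)) i (==F-refl (ι1 (w i)))

  inW-false : ∀ p → (∀ i → ι1 (w i) ≢ p) → inW p ≡ false
  inW-false p not-w = any-allFin-false _ (λ i → ≢⇒==F-false (not-w i))

  inW-u : inW (ι1 u) ≡ false
  inW-u = inW-false _ (λ i e → w≢u i (ι1-injective e))

  inW-v : inW (ι1 v) ≡ false
  inW-v = inW-false _ (λ i e → w≢v i (ι1-injective e))

  inW-ι3 : ∀ c → inW (ι3 c) ≡ false
  inW-ι3 c = inW-false _ (λ i e → w≢v i (proj₂ (ι3≡ι1 {c} (sym e))))

  starTo-outside : ∀ c p q → inW p ≡ false → inW q ≡ false → starTo c p q ≡ false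
  starTo-outside c p q p∉W q∉W rewrite p∉W | q∉W | ∧-zeroʳ (p ==F c) | ∧-zeroʳ (q ==F c) = refl

  starTo-away : ∀ c p q → p ≢ c → q ≢ c → starTo c p q ≡ false
  starTo-away c p q p≢c q≢c rewrite ≢⇒==F-false p≢c | ≢⇒==F-false q≢c = refl

  starTo-sym : ∀ c p q → starTo c p q ≡ starTo c q p
  starTo-sym c p q = ∨-comm ((p ==F c) ∧ inW q) ((q ==F c) ∧ inW p)

  G-sym : ∀ p q → G p q ≡ G q p
  G-sym p q = cong₂ _∨_ (imgAdj-sym ι1 G1 sym₁ p q)
                (cong₂ _∨_ (imgAdj-sym ι2 G2 sym₂ p q) (imgAdj-sym ι3 (pathGraph s) (pathGraph-sym s) p q))

  G'-sym : ∀ p q → G' p q ≡ G' q p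
  G'-sym p q = cong₂ _∨_ (cong₂ _∧_ (G-sym p q) (cong not (starTo-sym (ι1 v) p q))) (starTo-sym (ι2 x2) p q)

  data Edge : Fin N → Fin N → Set where
    edge₁ : ∀ {i j} → G1 i j ≡ true → Edge (ι1 i) (ι1 j)
    edge₂ : ∀ {g h} → G2 g h ≡ true → Edge (ι2 g) (ι2 h)
    edge₃ : ∀ {c d} → pathGraph s c d ≡ true → Edge (ι3 c) (ι3 d)

  G-edge : ∀ {p q} → G p q ≡ true → Edge p q
  G-edge {p} {q} e with ∨-elim (imgAdj ι1 G1 p q) e
  ... | inj₁ e₁ with imgAdj-elim ι1 G1 p q e₁
  ...   | i , j , Hij , refl , refl = edge₁ Hij
  G-edge {p} {q} e | inj₂ e₂₃ with ∨-elim (imgAdj ι2 G2 p q) e₂₃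
  ... | inj₁ e₂ with imgAdj-elim ι2 G2 p q e₂
  ...   | g , h , Hgh , refl , refl = edge₂ Hgh
  G-edge {p} {q} e | inj₂ e₂₃ | inj₂ e₃ with imgAdj-elim ι3 (pathGraph s) p q e₃
  ...   | c , d , Hcd , refl , refl = edge₃ {c} {d} Hcd

  G-ι1 : ∀ {i j} → G1 i j ≡ true → G (ι1 i) (ι1 j) ≡ true
  G-ι1 {i} {j} e = ∨-introˡ _ (imgAdj-intro ι1 G1 i j e)

  G-ι2 : ∀ {g h} → G2 g h ≡ true → G (ι2 g) (ι2 h) ≡ true
  G-ι2 {g} {h} e = ∨-introʳ (imgAdj ι1 G1 _ _) (∨-introˡ _ (imgAdj-intro ι2 G2 g h e))

  G-ι3 : ∀ c d → pathGraph s c d ≡ true → G (ι3 c) (ι3 d) ≡ true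
  G-ι3 c d e = ∨-introʳ (imgAdj ι1 G1 _ _) (∨-introʳ (imgAdj ι2 G2 _ _) (imgAdj-intro ι3 (pathGraph s) c d e))

  G'-kept : ∀ {p q} → G p q ≡ true → starTo (ι1 v) p q ≡ false → G' p q ≡ true
  G'-kept {p} {q} Gpq kept = ∨-introˡ _ (∧-intro Gpq (not-intro kept))

  G'-x2-w : ∀ i → G' (ι2 x2) (ι1 (w i)) ≡ true
  G'-x2-w i = ∨-introʳ (G (ι2 x2) (ι1 (w i)) ∧ not (starTo (ι1 v) (ι2 x2) (ι1 (w i))))
                (∨-introˡ _ (∧-intro (==F-refl (ι2 x2)) (inW-w i)))

  G'-w-x2 : ∀ i → G' (ι1 (w i)) (ι2 x2) ≡ true
  G'-w-x2 i = trans (G'-sym _ _) (G'-x2-w i)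

  G'-ι1 : ∀ {i j} → G1 i j ≡ true → i ≢ v → j ≢ v → G' (ι1 i) (ι1 j) ≡ true
  G'-ι1 e i≢v j≢v =
    G'-kept (G-ι1 e) (starTo-away _ _ _ (λ z → i≢v (ι1-injective z)) (λ z → j≢v (ι1-injective z)))

  G'-uv : G' (ι1 u) (ι1 v) ≡ true
  G'-uv = G'-kept (G-ι1 uv) (starTo-outside _ _ _ inW-u inW-v)

  G'-vu : G' (ι1 v) (ι1 u) ≡ true
  G'-vu = trans (G'-sym _ _) G'-uv

  ι2≢ι1v : ∀ g → ι2 g ≢ ι1 v
  ι2≢ι1v g e = u≢v (sym (proj₂ (ι2≡ι1 e)))

  G'-ι2 : ∀ {g h} → G2 g h ≡ true → G' (ι2 g) (ι2 h) ≡ true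
  G'-ι2 {g} {h} e = G'-kept (G-ι2 e) (starTo-away _ _ _ (ι2≢ι1v g) (ι2≢ι1v h))

  G'-ι3 : ∀ c d → pathGraph s c d ≡ true → G' (ι3 c) (ι3 d) ≡ true
  G'-ι3 c d e = G'-kept (G-ι3 c d e) (starTo-outside _ _ _ (inW-ι3 c) (inW-ι3 d))

  fold-v : Fin a → Fin a
  fold-v i with i ≟ v
  ... | yes _ = u
  ... | no _  = i

  fold-v-v : fold-v v ≡ u
  fold-v-v with v ≟ v
  ... | yes _   = refl
  ... | no v≢v  = ⊥-elim (v≢v refl)

  fold-v-≢ : ∀ i → i ≢ v → fold-v i ≡ i
  fold-v-≢ i i≢v with i ≟ v
  ... | yes i≡v = ⊥-elim (i≢v i≡v)
  ... | no _    = refl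

  fold-v-≢v : ∀ i → fold-v i ≢ v
  fold-v-≢v i with i ≟ v
  ... | yes _   = u≢v
  ... | no i≢v  = i≢v

  -- Merging v into u keeps G1-edges: v's other neighbours are those of u.
  fold-v-contraction : IsContraction G1 G1 fold-v
  fold-v-contraction i j e with i ≟ v | j ≟ v
  ... | yes refl | yes refl = inj₂ refl
  ... | yes refl | no j≢v with j ≟ u
  ...   | yes refl = inj₂ refl
  ...   | no j≢u with N-v⊆w j e j≢u
  ...     | m , refl = inj₁ (u-w m)
  fold-v-contraction i j e | no i≢v | yes refl with i ≟ u
  ...   | yes refl = inj₂ refl
  ...   | no i≢u with N-v⊆w i (trans (sym₁ v i) e) i≢u
  ...     | m , refl = inj₁ (trans (sym₁ (w m) u) (u-w m))
  fold-v-contraction i j e | no _ | no _ = inj₁ e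

  fold-v-G' : IsContraction G1 G' (λ i → ι1 (fold-v i))
  fold-v-G' i j e with fold-v-contraction i j e
  ... | inj₁ e′ = inj₁ (G'-ι1 e′ (fold-v-≢v i) (fold-v-≢v j))
  ... | inj₂ eq = inj₂ (cong ι1 eq)

  -- In G', both u and v can be replaced by x2: every other neighbour of them is a w_i.
  lift-uv : Fin a → Fin N
  lift-uv i with i ≟ u | i ≟ v
  ... | yes _ | _     = ι2 x2
  ... | no _  | yes _ = ι2 x2
  ... | no _  | no _  = ι1 i

  lift-uv-u : lift-uv u ≡ ι2 x2
  lift-uv-u with u ≟ u
  ... | yes _  = refl
  ... | no u≢u = ⊥-elim (u≢u refl)

  lift-uv-≢ : ∀ i → i ≢ u → i ≢ v → lift-uv i ≡ ι1 i
  lift-uv-≢ i i≢u i≢v with i ≟ u | i ≟ v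
  ... | yes i≡u | _       = ⊥-elim (i≢u i≡u)
  ... | no _    | yes i≡v = ⊥-elim (i≢v i≡v)
  ... | no _    | no _    = refl

  N-uv⊆w : ∀ i j → G1 i j ≡ true → (i ≡ u) ⊎ (i ≡ v) → j ≢ u → j ≢ v → ∃ λ m → w m ≡ j
  N-uv⊆w i j e (inj₁ refl) j≢u j≢v = N-u⊆w j e j≢v
  N-uv⊆w i j e (inj₂ refl) j≢u j≢v = N-v⊆w j e j≢u

  lift-uv-contraction : IsContraction G1 G' lift-uv
  lift-uv-contraction i j e with i ≟ u | i ≟ v | j ≟ u | j ≟ v
  ... | yes refl | _        | yes refl | _        = inj₂ refl
  ... | yes refl | _        | no _     | yes refl = inj₂ refl
  ... | no _     | yes refl | yes refl | _        = inj₂ refl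
  ... | no _     | yes refl | no _     | yes refl = inj₂ refl
  ... | yes refl | _        | no j≢u   | no j≢v with N-uv⊆w u j e (inj₁ refl) j≢u j≢v
  ...   | m , refl = inj₁ (G'-x2-w m)
  lift-uv-contraction i j e | no _ | yes refl | no j≢u | no j≢v with N-uv⊆w v j e (inj₂ refl) j≢u j≢v
  ...   | m , refl = inj₁ (G'-x2-w m)
  lift-uv-contraction i j e | no i≢u | no i≢v | yes refl | _ with N-uv⊆w u i (trans (sym₁ u i) e) (inj₁ refl) i≢u i≢v
  ...   | m , refl = inj₁ (G'-w-x2 m)
  lift-uv-contraction i j e | no i≢u | no i≢v | no _ | yes refl with N-uv⊆w v i (trans (sym₁ v i) e) (inj₂ refl) i≢u i≢v
  ...   | m , refl = inj₁ (G'-w-x2 m)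
  lift-uv-contraction i j e | no _ | no i≢v | no _ | no j≢v = inj₁ (G'-ι1 e i≢v j≢v)

  collapse-to-u : Fin a → Fin N
  collapse-to-u i with i ≟ u | i ≟ v
  ... | yes _ | _     = ι1 i
  ... | no _  | yes _ = ι1 i
  ... | no _  | no _  = ι1 u

  collapse-to-u-u : collapse-to-u u ≡ ι1 u
  collapse-to-u-u with u ≟ u
  ... | yes _  = refl
  ... | no u≢u = ⊥-elim (u≢u refl)

  collapse-to-u-v : collapse-to-u v ≡ ι1 v
  collapse-to-u-v with v ≟ u | v ≟ v
  ... | yes _ | _      = refl
  ... | no _  | yes _  = refl
  ... | no _  | no v≢v = ⊥-elim (v≢v refl)

  collapse-to-u-contraction : IsContraction G1 G' collapse-to-u
  collapse-to-u-contraction i j e with i ≟ u | i ≟ v | j ≟ u | j ≟ v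
  ... | yes refl | _        | yes refl | _        = inj₂ refl
  ... | yes refl | _        | no _     | yes refl = inj₁ G'-uv
  ... | yes refl | _        | no _     | no _     = inj₂ refl
  ... | no _     | yes refl | yes refl | _        = inj₁ G'-vu
  ... | no _     | yes refl | no _     | yes refl = inj₂ refl
  ... | no _     | yes refl | no _     | no _     = inj₁ G'-vu
  ... | no _     | no _     | yes refl | _        = inj₂ refl
  ... | no _     | no _     | no _     | yes refl = inj₁ G'-uv
  ... | no _     | no _     | no _     | no _     = inj₂ refl

  -- Every pair except an inner vertex of G1 with a vertex of P_s is fixed by ρ or by π,
  -- and these maps do not lengthen walks, so such pairs do not get farther apart in G'.
  ρ : Fin N → Fin N
  ρ = glue (λ i → ι1 (fold-v i)) ι2 (λ _ → ι1 u)

  π : Fin N → Fin N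
  π = glue collapse-to-u ι2 ι3

  ρ-ι1 : ∀ i → ρ (ι1 i) ≡ ι1 (fold-v i)
  ρ-ι1 = glue-ι1 _ ι2 _

  ρ-ι2 : ∀ g → ρ (ι2 g) ≡ ι2 g
  ρ-ι2 = glue-ι2-all _ ι2 _ (trans (cong ι1 (fold-v-≢ u u≢v)) (sym ι2-x1))

  ρ-ι3 : ∀ c → ρ (ι3 c) ≡ ι1 u
  ρ-ι3 = glue-ι3 _ ι2 (λ _ → ι1 u) (cong ι1 fold-v-v)

  π-ι1 : ∀ i → π (ι1 i) ≡ collapse-to-u i
  π-ι1 = glue-ι1 collapse-to-u ι2 ι3

  π-ι2 : ∀ g → π (ι2 g) ≡ ι2 g
  π-ι2 = glue-ι2-all collapse-to-u ι2 ι3 (trans collapse-to-u-u (sym ι2-x1))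

  π-ι3 : ∀ c → π (ι3 c) ≡ ι3 c
  π-ι3 = glue-ι3 collapse-to-u ι2 ι3 collapse-to-u-v

  ρ-contraction : IsContraction G G' ρ
  ρ-contraction p q e with G-edge e
  ... | edge₁ {i} {j} e₁ rewrite ρ-ι1 i | ρ-ι1 j = fold-v-G' i j e₁
  ... | edge₂ {g} {h} e₂ rewrite ρ-ι2 g | ρ-ι2 h = inj₁ (G'-ι2 e₂)
  ... | edge₃ {c} {d} _  rewrite ρ-ι3 c | ρ-ι3 d = inj₂ refl

  π-contraction : IsContraction G G' π
  π-contraction p q e with G-edge e
  ... | edge₁ {i} {j} e₁ rewrite π-ι1 i | π-ι1 j = collapse-to-u-contraction i j e₁
  ... | edge₂ {g} {h} e₂ rewrite π-ι2 g | π-ι2 h = inj₁ (G'-ι2 e₂)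
  ... | edge₃ {c} {d} e₃ rewrite π-ι3 c | π-ι3 d = inj₁ (G'-ι3 c d e₃)

  module M₁ = Metric G1 connected₁
  module M₂ = Metric G2 connected₂

  δ : Fin a → Fin a → ℕ
  δ = M₁.d

  depth : Fin (suc b) → ℕ
  depth = M₂.d x1

  -- x_{m+1} of the paper is X m.
  X : ℕ → Fin (suc b)
  X m = x (clamp (suc r) m)

  X-edge : ∀ i → i < suc r → G2 (X i) (X (suc i)) ≡ true
  X-edge i (s≤s i≤r) = subst (λ z → G2 (x z) (X (suc i)) ≡ true) (inject₁-clamp r i i≤r) (x-path (clamp r i))

  x1≢X : ∀ m → x1 ≢ X (suc m)
  x1≢X m e with x-injective e
  ... | ()

  X-injective : ∀ m m′ → m ≤ r → m′ ≤ r → X (suc m) ≡ X (suc m′) → m ≡ m′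
  X-injective m m′ m≤r m′≤r e = suc-injective (trans (sym (toℕ-clamp (suc r) (suc m) (s≤s m≤r)))
    (trans (cong toℕ (x-injective e)) (toℕ-clamp (suc r) (suc m′) (s≤s m′≤r))))

  -- x1 … x_t is a geodesic, so x_{i+1} is at depth at least i below x1.
  depth-X : ∀ i → i ≤ suc r → i ≤ depth (X i)
  depth-X i i≤1+r =
    +-cancelʳ-≤ (suc r ∸ i) i (depth (X i)) (subst (_≤ depth (X i) + (suc r ∸ i)) (sym (m+[n∸m]≡n i≤1+r)) long)
    where
      walk : within G2 (depth (X i) + (suc r ∸ i)) x1 (X (suc r)) ≡ true
      walk = subst (λ z → within G2 (depth (X i) + (suc r ∸ i)) x1 (X z) ≡ true) (m+[n∸m]≡n i≤1+r)
               (Walks.within-trans G2 (depth (X i)) (suc r ∸ i) (M₂.d-walk x1 (X i))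
                 (Walks.within-path G2 X (suc r) X-edge (suc r ∸ i) i (≤-reflexive (m+[n∸m]≡n i≤1+r))))
      long : suc r ≤ depth (X i) + (suc r ∸ i)
      long = Distance.dist-minimal G2 x-geodesic
               (subst (λ z → within G2 (depth (X i) + (suc r ∸ i)) x1 z ≡ true) (cong x (clamp-self (suc r))) walk)

  φ : Fin a → Fin N → ℕ
  φ y = glue (δ y) (λ g → δ y u + depth g) (λ c → δ y v + toℕ c)

  φ-ι1 : ∀ y i → φ y (ι1 i) ≡ δ y i
  φ-ι1 y = glue-ι1 (δ y) _ _

  φ-ι2 : ∀ y g → φ y (ι2 g) ≡ δ y u + depth g
  φ-ι2 y = glue-ι2-all (δ y) _ _ (sym (trans (cong (δ y u +_) (M₂.d-self x1)) (+-identityʳ (δ y u))))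

  φ-ι3 : ∀ y c → φ y (ι3 c) ≡ δ y v + toℕ c
  φ-ι3 y = glue-ι3 (δ y) _ _ (sym (+-identityʳ (δ y v)))

  φ-lipschitz : ∀ y p q → G p q ≡ true → φ y q ≤ suc (φ y p)
  φ-lipschitz y p q e with G-edge e
  ... | edge₁ {i} {j} e₁ rewrite φ-ι1 y i | φ-ι1 y j = M₁.d-lipschitz y e₁
  ... | edge₂ {g} {h} e₂ rewrite φ-ι2 y g | φ-ι2 y h =
    ≤-trans (+-monoʳ-≤ (δ y u) (M₂.d-lipschitz x1 e₂)) (≤-reflexive (+-suc (δ y u) (depth g)))
  ... | edge₃ {c} {d} e₃ rewrite φ-ι3 y c | φ-ι3 y d =
    ≤-trans (+-monoʳ-≤ (δ y v) (pathGraph-lipschitz s c d e₃)) (≤-reflexive (+-suc (δ y v) (toℕ c)))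

  φ-≤-walk : ∀ y {q k} → within G k (ι1 y) q ≡ true → φ y q ≤ k
  φ-≤-walk y {q} {k} walk = subst (φ y q ≤_) (cong (_+ k) (trans (φ-ι1 y y) (M₁.d-self y)))
    (Walks.potential-≤-walk G (φ y) (φ-lipschitz y) k walk)

  δu≤δv : ∀ y → y ≢ v → δ y u ≤ δ y v
  δu≤δv y y≢v = M₁.d-minimal (subst₂ (λ p q → within G1 (δ y v) p q ≡ true) (fold-v-≢ y y≢v) fold-v-v
    (within-map G1 G1 fold-v fold-v-contraction (δ y v) (M₁.d-walk y v)))

  walk-to-X : ∀ y i {k} → i ≤ suc r → within G k (ι1 y) (ι2 (X i)) ≡ true → δ y u + i ≤ k
  walk-to-X y i {k} i≤1+r walk =
    ≤-trans (+-monoʳ-≤ (δ y u) (depth-X i i≤1+r)) (subst (_≤ k) (φ-ι2 y (X i)) (φ-≤-walk y walk))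

  walk-to-P : ∀ y c {k} → y ≢ v → within G k (ι1 y) (ι3 c) ≡ true → δ y u + toℕ c ≤ k
  walk-to-P y c {k} y≢v walk =
    ≤-trans (+-monoˡ-≤ (toℕ c) (δu≤δv y y≢v)) (subst (_≤ k) (φ-ι3 y c) (φ-≤-walk y walk))

  walk′-to-X : ∀ y m → y ≢ u → y ≢ v → m ≤ r → within G' (δ y u + m) (ι1 y) (ι2 (X (suc m))) ≡ true
  walk′-to-X y m y≢u y≢v m≤r = Walks.within-trans G' (δ y u) m to-x2 along-x
    where
      to-x2 : within G' (δ y u) (ι1 y) (ι2 x2) ≡ true
      to-x2 = subst₂ (λ p q → within G' (δ y u) p q ≡ true) (lift-uv-≢ y y≢u y≢v) lift-uv-u
                (within-map G1 G' lift-uv lift-uv-contraction (δ y u) (M₁.d-walk y u))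
      along-x : within G' m (ι2 x2) (ι2 (X (suc m))) ≡ true
      along-x = Walks.within-path G' (λ i → ι2 (X i)) (suc r) (λ i i<1+r → G'-ι2 (X-edge i i<1+r)) m 1 (s≤s m≤r)

  walk′-to-P : ∀ y c → y ≢ v → within G' (δ y u + suc (toℕ c)) (ι1 y) (ι3 c) ≡ true
  walk′-to-P y c y≢v = Walks.within-trans G' (δ y u) (suc (toℕ c)) to-u (Walks.within-step G' (toℕ c) G'-uv along-P)
    where
      to-u : within G' (δ y u) (ι1 y) (ι1 u) ≡ true
      to-u = subst₂ (λ p q → within G' (δ y u) p q ≡ true) (cong ι1 (fold-v-≢ y y≢v)) (cong ι1 (fold-v-≢ u u≢v))
               (within-map G1 G' (λ i → ι1 (fold-v i)) fold-v-G' (δ y u) (M₁.d-walk y u))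
      along-P : within G' (toℕ c) (ι1 v) (ι3 c) ≡ true
      along-P = subst (λ z → within G' (toℕ c) (ι1 v) (ι3 z) ≡ true) (clamp-toℕ s' c)
                  (Walks.within-path G' (λ i → ι3 (clamp s' i)) s'
                    (λ i i<s' → G'-ι3 (clamp s' i) (clamp s' (suc i)) (pathGraph-clamp s' i i<s'))
                    (toℕ c) 0 (≤-pred (toℕ<n c)))

  gap : Fin a → ℕ → ℚ
  gap y m = recipℕ (δ y u + m) -ℚ recipℕ (δ y u + suc m)

  gap-pos : ∀ y m → y ≢ u → 0ℚ <ℚ gap y m
  gap-pos y m y≢u = ->0 (subst (λ z → recipℕ z <ℚ recipℕ (δ y u + m)) (sym (+-suc (δ y u) m))
    (recipℕ-strict (≤-trans (M₁.d-pos y≢u) (m≤m+n (δ y u) m))))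

  gain-pair : ∀ y m → y ≢ u → y ≢ v → m ≤ r →
              recipDist (dist G (ι1 y) (ι2 (X (suc m)))) +ℚ gap y m ≤ℚ recipDist (dist G' (ι1 y) (ι2 (X (suc m))))
  gain-pair y m y≢u y≢v m≤r = gain-≤
    (recipDist-≤-of-walks G (δ y u + suc m) (≤-trans (M₁.d-pos y≢u) (m≤m+n (δ y u) (suc m)))
      (λ k → walk-to-X y (suc m) (s≤s m≤r)))
    (recipℕ-≤-recipDist G' (δ y u + m) (ι1≢ι2 y (X (suc m)) (x1≢X m)) (walk′-to-X y m y≢u y≢v m≤r))

  loss-pair : ∀ y c → y ≢ u → y ≢ v →
              recipDist (dist G (ι1 y) (ι3 c)) ≤ℚ recipDist (dist G' (ι1 y) (ι3 c)) +ℚ gap y (toℕ c)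
  loss-pair y c y≢u y≢v = loss-≤
    (recipDist-≤-of-walks G (δ y u + toℕ c) (≤-trans (M₁.d-pos y≢u) (m≤m+n (δ y u) (toℕ c)))
      (λ k → walk-to-P y c y≢v))
    (recipℕ-≤-recipDist G' (δ y u + suc (toℕ c)) (λ e → y≢v (proj₂ (ι3≡ι1 {c} (sym e)))) (walk′-to-P y c y≢v))

  isInner : Fin a → Bool
  isInner y = not (y ==F u) ∧ not (y ==F v)

  isInner-true : ∀ {y} → y ≢ u → y ≢ v → isInner y ≡ true
  isInner-true y≢u y≢v rewrite ≢⇒==F-false y≢u | ≢⇒==F-false y≢v = refl

  isInner-u : isInner u ≡ false
  isInner-u rewrite ==F-refl u = refl

  isInner-v : isInner v ≡ false
  isInner-v rewrite ==F-refl v = ∧-zeroʳ (not (v ==F u))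

  -- Both the loss of the pair (ι1 y, z_{c+1}) and the gain of the pair (ι1 y, x_{m+2}) are
  -- measured by weight (ι1 y) = gap y, which is set to 0 unless y is an inner vertex.
  weight : Fin N → ℕ → ℚ
  weight p m = glue (λ y → if isInner y then gap y m else 0ℚ) (λ _ → 0ℚ) (λ _ → 0ℚ) p

  weight-ι1 : ∀ y m → weight (ι1 y) m ≡ (if isInner y then gap y m else 0ℚ)
  weight-ι1 y m = glue-ι1 _ _ _ y

  weight-inner : ∀ {y} m → y ≢ u → y ≢ v → weight (ι1 y) m ≡ gap y m
  weight-inner {y} m y≢u y≢v = trans (weight-ι1 y m) (cong (if_then gap y m else 0ℚ) (isInner-true y≢u y≢v))

  data Outer : Fin N → Set where
    at-u  : Outer (ι1 u)
    at-v  : Outer (ι1 v)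
    in-G2 : ∀ g → Outer (ι2 g)
    in-P  : ∀ j → Outer (ι3 (suc j))

  data Kind : Fin N → Set where
    inner : ∀ y → y ≢ u → y ≢ v → Kind (ι1 y)
    outer : ∀ {p} → Outer p → Kind p

  kind : ∀ p → Kind p
  kind p with locate p
  ... | at₁ y refl with y ≟ u | y ≟ v
  ...   | yes refl | _        = outer at-u
  ...   | no _     | yes refl = outer at-v
  ...   | no y≢u   | no y≢v   = inner y y≢u y≢v
  kind p | at₂ g _ refl = outer (in-G2 g)
  kind p | at₃ j refl   = outer (in-P j)

  outer-π : ∀ {p} → Outer p → π p ≡ p
  outer-π at-u      = trans (π-ι1 u) collapse-to-u-u
  outer-π at-v      = trans (π-ι1 v) collapse-to-u-v
  outer-π (in-G2 g) = π-ι2 g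
  outer-π (in-P j)  = π-ι3 (suc j)

  outer-weight : ∀ {p} → Outer p → ∀ m → weight p m ≡ 0ℚ
  outer-weight at-u      m = trans (weight-ι1 u m) (cong (if_then gap u m else 0ℚ) isInner-u)
  outer-weight at-v      m = trans (weight-ι1 v m) (cong (if_then gap v m else 0ℚ) isInner-v)
  outer-weight (in-G2 g) m = glue-ι2-all _ (λ _ → 0ℚ) _ (cong (if_then gap u m else 0ℚ) isInner-u) g
  outer-weight (in-P j)  m = glue-ι3-suc _ _ (λ _ → 0ℚ) j

  weight-nonneg : ∀ p m → 0ℚ ≤ℚ weight p m
  weight-nonneg p m with kind p
  ... | inner y y≢u y≢v = ℚ.≤-trans (ℚ.<⇒≤ (gap-pos y m y≢u)) (ℚ.≤-reflexive (sym (weight-inner m y≢u y≢v)))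
  ... | outer o         = ℚ.≤-reflexive (sym (outer-weight o m))

  ρ-fixes : ∀ y → y ≢ v → ρ (ι1 y) ≡ ι1 y
  ρ-fixes y y≢v = trans (ρ-ι1 y) (cong ι1 (fold-v-≢ y y≢v))

  ι2≢ι3-all : ∀ g c → ι2 g ≢ ι3 c
  ι2≢ι3-all g zero    e = u≢v (sym (proj₂ (ι2≡ι1 e)))
  ι2≢ι3-all g (suc j) e with ι2-cases g
  ... | inj₁ (_ , eg)    = ι1≢ι3 u j (trans (sym eg) e)
  ... | inj₂ (x1≢g , _)  = ι2≢ι3 g j x1≢g e

  m<1+s⇒m≤r : ∀ {m} → m < suc s → m ≤ r
  m<1+s⇒m≤r m<1+s = ≤-trans (≤-pred m<1+s) s≤r

  gainAt : Fin N → Fin N → ℚ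
  gainAt i j = sumOver (range (suc s)) (restrict (λ m → j ==F ι2 (X (suc m))) (weight i))

  lossAt : Fin N → Fin N → ℚ
  lossAt i j = sumOver (range s) (restrict (λ c → j ==F ι3 (clamp s' c)) (weight i))

  gainAt-miss : ∀ i j → (∀ m → j ≢ ι2 (X (suc m))) → gainAt i j ≡ 0ℚ
  gainAt-miss i j miss = sumOver-range-none (suc s) _ (weight i) (λ m _ → ≢⇒==F-false (miss m))

  gainAt-outer : ∀ {i} j → Outer i → gainAt i j ≡ 0ℚ
  gainAt-outer j o = sumOver-restrict-zero (range (suc s)) _ _ (outer-weight o)

  gainAt-ι1 : ∀ i y → gainAt i (ι1 y) ≡ 0ℚ
  gainAt-ι1 i y = gainAt-miss i (ι1 y) (λ m → ι1≢ι2 y (X (suc m)) (x1≢X m))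

  gainAt-ι3 : ∀ i c → gainAt i (ι3 c) ≡ 0ℚ
  gainAt-ι3 i c = gainAt-miss i (ι3 c) (λ m e → ι2≢ι3-all (X (suc m)) c (sym e))

  gainAt-ι2 : ∀ i g → (∃ λ m₀ → (m₀ < suc s) × (g ≡ X (suc m₀)) × (gainAt i (ι2 g) ≡ weight i m₀))
                      ⊎ (gainAt i (ι2 g) ≡ 0ℚ)
  gainAt-ι2 i g with search (suc s) (λ m → ι2 g ==F ι2 (X (suc m)))
  ... | inj₂ none = inj₂ (sumOver-range-none (suc s) _ (weight i) none)
  ... | inj₁ (m₀ , m₀<1+s , hit) = inj₁ (m₀ , m₀<1+s , g≡X hit ,
        sumOver-range-unique (suc s) _ (weight i) m₀ m₀<1+s hit
          (λ m m<1+s hit′ → X-injective m m₀ (m<1+s⇒m≤r m<1+s) (m<1+s⇒m≤r m₀<1+s) (trans (sym (g≡X hit′)) (g≡X hit))))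
    where
      g≡X : ∀ {m} → (ι2 g ==F ι2 (X (suc m))) ≡ true → g ≡ X (suc m)
      g≡X e = ι2-injective (==F⇒≡ e)

  lossAt-ι3 : ∀ i c → lossAt i (ι3 c) ≡ weight i (toℕ c)
  lossAt-ι3 i c = sumOver-range-unique s _ (weight i) (toℕ c) (toℕ<n c)
    (trans (cong (λ z → ι3 c ==F ι3 z) (clamp-toℕ s' c)) (==F-refl (ι3 c)))
    (λ m m<s e → trans (sym (toℕ-clamp s' m (≤-pred m<s))) (cong toℕ (sym (ι3-injective (==F⇒≡ e)))))

  lossAt-diag : ∀ i → lossAt i i ≡ 0ℚ
  lossAt-diag i with kind i
  ... | inner y _ y≢v = sumOver-range-none s _ (weight (ι1 y))
                          (λ c _ → ≢⇒==F-false (λ e → y≢v (proj₂ (ι3≡ι1 {clamp s' c} (sym e)))))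
  ... | outer o       = sumOver-restrict-zero (range s) _ _ (outer-weight o)


  lossAt-nonneg : ∀ i j → 0ℚ ≤ℚ lossAt i j
  lossAt-nonneg i j = sumOver-restrict-nonneg (range s) (λ c → j ==F ι3 (clamp s' c)) (weight i) (weight-nonneg i)

  PairBound : Fin N → Fin N → Set
  PairBound i j = recipDist (dist G i j) +ℚ gainAt i j ≤ℚ recipDist (dist G' i j) +ℚ (lossAt i j +ℚ lossAt j i)

  gaining : ∀ i j → recipDist (dist G i j) +ℚ gainAt i j ≤ℚ recipDist (dist G' i j) → PairBound i j
  gaining i j bound = ℚ.≤-trans bound (≤-+-nonneg (ℚ.+-mono-≤ (lossAt-nonneg i j) (lossAt-nonneg j i)))

  drop-gain : ∀ i j → gainAt i j ≡ 0ℚ → recipDist (dist G i j) +ℚ gainAt i j ≡ recipDist (dist G i j)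
  drop-gain i j no-gain = trans (cong (recipDist (dist G i j) +ℚ_) no-gain) (ℚ.+-identityʳ _)

  neutral : ∀ i j → gainAt i j ≡ 0ℚ → recipDist (dist G i j) ≤ℚ recipDist (dist G' i j) → PairBound i j
  neutral i j no-gain bound = gaining i j (ℚ.≤-trans (ℚ.≤-reflexive (drop-gain i j no-gain)) bound)

  losing : ∀ i j {ℓ} → gainAt i j ≡ 0ℚ → recipDist (dist G i j) ≤ℚ recipDist (dist G' i j) +ℚ ℓ →
           ℓ ≤ℚ lossAt i j +ℚ lossAt j i → PairBound i j
  losing i j no-gain bound ℓ≤loss =
    ℚ.≤-trans (ℚ.≤-reflexive (drop-gain i j no-gain)) (ℚ.≤-trans bound (ℚ.+-monoʳ-≤ (recipDist (dist G' i j)) ℓ≤loss))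

  via-ρ : ∀ {i j} → ρ i ≡ i → ρ j ≡ j → i ≢ j → recipDist (dist G i j) ≤ℚ recipDist (dist G' i j)
  via-ρ = recipDist-contraction G G' ρ ρ-contraction

  via-π : ∀ {i j} → π i ≡ i → π j ≡ j → i ≢ j → recipDist (dist G i j) ≤ℚ recipDist (dist G' i j)
  via-π = recipDist-contraction G G' π π-contraction

  loss-weight : ∀ {y} c → y ≢ u → y ≢ v → lossAt (ι1 y) (ι3 c) ≡ gap y (toℕ c)
  loss-weight c y≢u y≢v = trans (lossAt-ι3 _ c) (weight-inner (toℕ c) y≢u y≢v)

  pair-bound : ∀ i j → toℕ i < toℕ j → PairBound i j
  pair-bound i j i<j with kind i | kind j
  ... | inner y y≢u y≢v | inner y′ _ y′≢v =
    neutral (ι1 y) (ι1 y′) (gainAt-ι1 _ y′) (via-ρ (ρ-fixes y y≢v) (ρ-fixes y′ y′≢v) (toℕ-≢ i<j))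
  ... | inner y y≢u y≢v | outer at-u =
    neutral (ι1 y) (ι1 u) (gainAt-ι1 _ u) (via-ρ (ρ-fixes y y≢v) (ρ-fixes u u≢v) (toℕ-≢ i<j))
  ... | inner y y≢u y≢v | outer at-v =
    losing (ι1 y) (ι1 v) (gainAt-ι1 _ v) (loss-pair y zero y≢u y≢v)
      (ℚ.≤-trans (ℚ.≤-reflexive (sym (loss-weight zero y≢u y≢v))) (≤-+-nonneg (lossAt-nonneg (ι1 v) (ι1 y))))
  ... | inner y y≢u y≢v | outer (in-P c) =
    losing (ι1 y) (ι3 (suc c)) (gainAt-ι3 _ (suc c)) (loss-pair y (suc c) y≢u y≢v)
      (ℚ.≤-trans (ℚ.≤-reflexive (sym (loss-weight (suc c) y≢u y≢v))) (≤-+-nonneg (lossAt-nonneg (ι3 (suc c)) (ι1 y))))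
  ... | inner y y≢u y≢v | outer (in-G2 g) with gainAt-ι2 (ι1 y) g
  ...   | inj₂ no-gain = neutral (ι1 y) (ι2 g) no-gain (via-ρ (ρ-fixes y y≢v) (ρ-ι2 g) (toℕ-≢ i<j))
  ...   | inj₁ (m₀ , m₀<1+s , refl , hit) =
    gaining (ι1 y) (ι2 (X (suc m₀)))
      (subst (λ z → recipDist (dist G (ι1 y) (ι2 (X (suc m₀)))) +ℚ z
                      ≤ℚ recipDist (dist G' (ι1 y) (ι2 (X (suc m₀)))))
        (sym (trans hit (weight-inner m₀ y≢u y≢v))) (gain-pair y m₀ y≢u y≢v (m<1+s⇒m≤r m₀<1+s)))
  pair-bound i j i<j | outer at-v | inner y y≢u y≢v =
    losing (ι1 v) (ι1 y) (gainAt-outer (ι1 y) at-v)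
      (subst₂ (λ d d′ → recipDist d ≤ℚ recipDist d′ +ℚ gap y 0)
        (Distance.dist-sym G G-sym (ι1 y) (ι1 v)) (Distance.dist-sym G' G'-sym (ι1 y) (ι1 v))
        (loss-pair y zero y≢u y≢v))
      (ℚ.≤-trans (ℚ.≤-reflexive (sym (loss-weight zero y≢u y≢v)))
        (ℚ.≤-trans (≤-+-nonneg (lossAt-nonneg (ι1 v) (ι1 y)))
          (ℚ.≤-reflexive (ℚ.+-comm (lossAt (ι1 y) (ι1 v)) (lossAt (ι1 v) (ι1 y))))))
  pair-bound i j i<j | outer at-u | inner y _ y≢v =
    neutral (ι1 u) (ι1 y) (gainAt-outer (ι1 y) at-u) (via-ρ (ρ-fixes u u≢v) (ρ-fixes y y≢v) (toℕ-≢ i<j))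
  pair-bound i j i<j | outer (in-G2 g) | inner y _ y≢v =
    neutral (ι2 g) (ι1 y) (gainAt-outer (ι1 y) (in-G2 g)) (via-ρ (ρ-ι2 g) (ρ-fixes y y≢v) (toℕ-≢ i<j))
  pair-bound i j i<j | outer (in-P c) | inner y _ _ =
    ⊥-elim (<-irrefl refl (<-trans i<j (<-≤-trans (toℕ-ι1 y) (≤-trans (m≤m+n a b) (toℕ-ι3 c)))))
  pair-bound i j i<j | outer o | outer o′ =
    neutral i j (gainAt-outer j o) (via-π (outer-π o) (outer-π o′) (toℕ-≢ i<j))

  ordered : (Fin N → Fin N → ℚ) → Fin N → Fin N → ℚ
  ordered F i j = if toℕ i <ᵇ toℕ j then F i j else 0ℚ

  Σ² : (Fin N → Fin N → ℚ) → ℚ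
  Σ² F = sumOver (allFin N) (λ i → sumOver (allFin N) (F i))

  Σ²-cong : ∀ {F H} → (∀ i j → F i j ≡ H i j) → Σ² F ≡ Σ² H
  Σ²-cong F≗H = sumOver-cong (allFin N) (λ i → sumOver-cong (allFin N) (F≗H i))

  Σ²-mono : ∀ {F H} → (∀ i j → F i j ≤ℚ H i j) → Σ² F ≤ℚ Σ² H
  Σ²-mono F≤H = sumOver-mono (allFin N) (λ i → sumOver-mono (allFin N) (F≤H i))

  Σ²-+ : ∀ F H → Σ² (λ i j → F i j +ℚ H i j) ≡ Σ² F +ℚ Σ² H
  Σ²-+ F H = trans (sumOver-cong (allFin N) (λ i → sumOver-+ (allFin N) (F i) (H i)))
                   (sumOver-+ (allFin N) (λ i → sumOver (allFin N) (F i)) (λ i → sumOver (allFin N) (H i)))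

  recipDists : Graph N → Fin N → Fin N → ℚ
  recipDists H i j = recipDist (dist H i j)

  Gain Loss : Fin N → Fin N → ℚ
  Gain = ordered gainAt
  Loss = ordered (λ i j → lossAt i j +ℚ lossAt j i)

  E surplus : ℚ
  E       = sumOver (allFin N) (λ i → sumOver (range s) (weight i))
  surplus = sumOver (allFin N) (λ i → weight i s)

  ordered-bound : ∀ i j → ordered (recipDists G) i j +ℚ Gain i j ≤ℚ ordered (recipDists G') i j +ℚ Loss i j
  ordered-bound i j with toℕ i <ᵇ toℕ j in i<j
  ... | true  = pair-bound i j (<ᵇ⇒< (toℕ i) (toℕ j) (≡true⇒T i<j))
  ... | false = ℚ.≤-refl

  -- Gains only occur between ι1 y and ι2 g, which are always listed in this order.
  gainAt-backward : ∀ i j → (toℕ i <ᵇ toℕ j) ≡ false → gainAt i j ≡ 0ℚ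
  gainAt-backward i j j≤i with kind i
  ... | outer o     = gainAt-outer j o
  ... | inner y _ _ = gainAt-miss (ι1 y) j (λ m j≡ → true≢false (trans (sym (<ᵇ-true
          (subst (λ z → toℕ (ι1 y) < toℕ z) (sym j≡)
            (<-≤-trans (toℕ-ι1 y) (proj₁ (toℕ-ι2 (X (suc m)) (x1≢X m))))))) j≤i))

  Gain≡gainAt : ∀ i j → Gain i j ≡ gainAt i j
  Gain≡gainAt i j with toℕ i <ᵇ toℕ j in i<j
  ... | true  = refl
  ... | false = sym (gainAt-backward i j i<j)

  total-gain : Σ² Gain ≡ E +ℚ surplus
  total-gain = begin
    Σ² Gain                                                     ≡⟨ Σ²-cong Gain≡gainAt ⟩
    Σ² gainAt                                                   ≡⟨ sumOver-cong (allFin N) row ⟩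
    sumOver (allFin N) (λ i → sumOver (range s) (weight i) +ℚ weight i s)
      ≡⟨ sumOver-+ (allFin N) (λ i → sumOver (range s) (weight i)) (λ i → weight i s) ⟩
    E +ℚ surplus                                                ∎
    where
      open ≡-Reasoning
      row : ∀ i → sumOver (allFin N) (gainAt i) ≡ sumOver (range s) (weight i) +ℚ weight i s
      row i = trans (sumOver-allFin-hits N (range (suc s)) (λ m → ι2 (X (suc m))) (weight i))
                    (sumOver-range-suc s (weight i))

  split-by-order : ∀ i j → ordered lossAt i j +ℚ (if toℕ j <ᵇ toℕ i then lossAt i j else 0ℚ) ≡ lossAt i j
  split-by-order i j with <-cmp (toℕ i) (toℕ j)
  ... | tri< i<j _ _ rewrite <ᵇ-true i<j | <ᵇ-false (<⇒≤ i<j) = ℚ.+-identityʳ (lossAt i j)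
  ... | tri> _ _ j<i rewrite <ᵇ-true j<i | <ᵇ-false (<⇒≤ j<i) = ℚ.+-identityˡ (lossAt i j)
  ... | tri≈ _ i≡j _ with toℕ-injective i≡j
  ...   | refl rewrite <ᵇ-false (≤-refl {toℕ i}) | lossAt-diag i = ℚ.+-identityˡ 0ℚ

  total-loss : Σ² Loss ≡ E
  total-loss = begin
    Σ² Loss
      ≡⟨ Σ²-cong (λ i j → if-+ (toℕ i <ᵇ toℕ j) (lossAt i j) (lossAt j i)) ⟩
    Σ² (λ i j → ordered lossAt i j +ℚ ordered (λ i j → lossAt j i) i j)
      ≡⟨ Σ²-+ (ordered lossAt) (ordered (λ i j → lossAt j i)) ⟩
    Σ² (ordered lossAt) +ℚ Σ² (ordered (λ i j → lossAt j i))
      ≡⟨ cong (Σ² (ordered lossAt) +ℚ_) (sumOver-swap (allFin N) (allFin N) (ordered (λ i j → lossAt j i))) ⟩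
    Σ² (ordered lossAt) +ℚ Σ² (λ i j → if toℕ j <ᵇ toℕ i then lossAt i j else 0ℚ)
      ≡⟨ sym (Σ²-+ (ordered lossAt) (λ i j → if toℕ j <ᵇ toℕ i then lossAt i j else 0ℚ)) ⟩
    Σ² (λ i j → ordered lossAt i j +ℚ (if toℕ j <ᵇ toℕ i then lossAt i j else 0ℚ))
      ≡⟨ Σ²-cong split-by-order ⟩
    Σ² lossAt
      ≡⟨ sumOver-cong (allFin N) (λ i → sumOver-allFin-hits N (range s) (λ c → ι3 (clamp s' c)) (weight i)) ⟩
    E ∎
    where open ≡-Reasoning

  surplus-pos : 0ℚ <ℚ surplus
  surplus-pos = sumOver-allFin-pos N (λ i → weight i s) (ι1 (w w₀)) (λ p → weight-nonneg p s)
    (ℚ.<-≤-trans (gap-pos (w w₀) s (w≢u w₀)) (ℚ.≤-reflexive (sym (weight-inner s (w≢u w₀) (w≢v w₀)))))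
    where
      w₀ : Fin k
      w₀ = fromℕ< k≥1

  harary-increases : harary G <ℚ harary G'
  harary-increases = <-of-surplus (harary G) (harary G') E surplus summed surplus-pos
    where
      open ℚ.≤-Reasoning
      summed : harary G +ℚ (E +ℚ surplus) ≤ℚ harary G' +ℚ E
      summed = begin
        harary G +ℚ (E +ℚ surplus)                                 ≡⟨ cong (harary G +ℚ_) (sym total-gain) ⟩
        Σ² (ordered (recipDists G)) +ℚ Σ² Gain                    ≡⟨ sym (Σ²-+ (ordered (recipDists G)) Gain) ⟩
        Σ² (λ i j → ordered (recipDists G) i j +ℚ Gain i j)       ≤⟨ Σ²-mono ordered-bound ⟩
        Σ² (λ i j → ordered (recipDists G') i j +ℚ Loss i j)      ≡⟨ Σ²-+ (ordered (recipDists G')) Loss ⟩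
        harary G' +ℚ Σ² Loss                                       ≡⟨ cong (harary G' +ℚ_) total-loss ⟩
        harary G' +ℚ E                                             ∎

mainTheorem1 : (a b s' r k : ℕ) → (G1 : Graph a) → (G2 : Graph (suc b)) →
    IsSimple G1 → IsSimple G2 → Connected G1 → Connected G2 → Connected (pathGraph (suc s')) →
    (u v : Fin a) → G1 u v ≡ true →
    (w : Fin k → Fin a) → Injective _≡_ _≡_ w → 1 ≤ k →
    (∀ y → ((G1 u y ≡ true × y ≢ v) → ∃ λ i → w i ≡ y) × ((∃ λ i → w i ≡ y) → (G1 u y ≡ true × y ≢ v))) →
    (∀ y → ((G1 v y ≡ true × y ≢ u) → ∃ λ i → w i ≡ y) × ((∃ λ i → w i ≡ y) → (G1 v y ≡ true × y ≢ u))) →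
    (x : Fin (suc (suc r)) → Fin (suc b)) → Injective _≡_ _≡_ x →
    (∀ (i : Fin (suc r)) → G2 (x (inject₁ i)) (x (suc i)) ≡ true) →
    dist G2 (x zero) (x (fromℕ (suc r))) ≡ just (suc r) →
    suc s' + 2 ≤ suc (suc r) →
    harary (Glue.G {a} {b} {s'} G1 u v G2 (x zero))
    <ℚ harary (Glue.Modify.G' {a} {b} {s'} G1 u v G2 (x zero) w (x (suc zero)))
mainTheorem1 a b s' r k G1 G2 simple₁ simple₂ connected₁ connected₂ _ u v uv w _ k≥1 N-u N-v
             x x-injective x-path x-geodesic s+2≤t =
  Transformation.harary-increases a b s' r k G1 G2 simple₁ simple₂ connected₁ connected₂ u v uv w k≥1 N-u N-v
    x x-injective x-path x-geodesic s+2≤t
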